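{- Let $G$ be a pseudograph without loops. Let $G_a$ and $G_b$ be bundle compatible tubes of $G$ which are adjacent or properly intersecting. Suppose their intersection is a set of tubes $\{G_{\wedge_i}\}$, let $G_\vee$ be a minimal tube containing both $G_a$ and $G_b$, and let $E_\vee$ be the set of edges contained in $G_\vee$ but in neither $G_a$ nor $G_b$. Then for any maximal tubing $T$ containing $G_\vee$, $$\Lambda(G_a) \ < \ \Lambda(G_\vee) - \Lambda(G_b) + \sum_i \Lambda(G_{\wedge_i}) - \sum_{e\in E_\vee} f_T(e).$$
   Context: $G$ is a finite graph allowing multiple edges, no loops. A tube is a proper connected subgraph $t$ of $G$ such that whenever two nodes of $t$ are joined by an edge of $G$, $t$ contains at least one edge joining them; two tubes are compatible if one properly contains the other or they are disjoint and cannot be connected by a single edge of $G$; a tubing is a set of pairwise compatible tubes not containing all connected components of $G$; maximal tubings are maximal under inclusion. Two tubes are adjacent if they are disjoint and joined by an edge. Bundles $B_1,\dots,B_p$: classes of edges with the same endpoints (single edges form bundles of size one), $b_i=|B_i|$. For a tube $G_t$: $V(t)$ its node set, $E(i,t)$ the edges of $B_i$ in $G_t$. Tubes $G_a,G_b$ are bundle compatible if for each $i$ one of $E(i,a)$, $E(i,b)$ contains the other. $|H|$ = number of nodes plus edges; $|G-G_t|$ = number of nodes and edges of $G$ not in $G_t$; $c=|G|^2$; $\Lambda(G_t)=c^{|V(t)|}+\sum_i c^{|E(i,t)|}+|G-G_t|^2$. For a maximal tubing $T$: order each $B_i$ as $e(i,1),\dots,e(i,b_i)$ by increasing number of tubes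 of $T$ not containing them; for $j<b_i$ let $G_{e(i,j)}$ be the largest tube of $T$ containing $e(i,j)$ but not $e(i,j+1)$; set $f_T(e(i,1))=c+\sum_{x=1}^{b_i-1}(2|G-G_{e(i,x)}|-1)$ and $f_T(e(i,j))=c^{j-1}(c-1)-(2|G-G_{e(i,j-1)}|-1)$ for $j\neq1$. -}

module Defs where

open import Data.Nat as ℕ using (ℕ; zero; suc; _+_; _*_; _∸_; _^_; _≤_; _<_)
open import Data.Nat.Properties using (<⇒≤)
open import Data.Integer as ℤ using (ℤ; +_)
open import Data.Fin as Fin using (Fin; toℕ; fromℕ<)
open import Data.Bool using (Bool; true; false; _∧_; not; if_then_else_)
open import Data.List using (List; []; _∷_)
open import Data.List.Relation.Unary.All using (All)
open import Data.List.Relation.Unary.Any using (Any)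
open import Data.List.Relation.Unary.AllPairs using (AllPairs)
open import Data.Product using (Σ; _×_; _,_; ∃; proj₁; proj₂)
open import Data.Sum using (_⊎_)
open import Relation.Nullary using (¬_)
open import Relation.Binary.PropositionalEquality using (_≡_; _≢_; refl)
open import Function.Definitions using (Bijective)

sumℕ : (n : ℕ) → (Fin n → ℕ) → ℕ
sumℕ zero    f = 0
sumℕ (suc n) f = f Fin.zero + sumℕ n (λ x → f (Fin.suc x))

sumℤ : (n : ℕ) → (Fin n → ℤ) → ℤ
sumℤ zero    f = + 0
sumℤ (suc n) f = f Fin.zero ℤ.+ sumℤ n (λ x → f (Fin.suc x))

count : (n : ℕ) → (Fin n → Bool) → ℕ
count n P = sumℕ n (λ x → if P x then 1 else 0)

-- Finite loopless multigraphs, presented through their bundles.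

record Graph : Set where
  field
    n     : ℕ
    p     : ℕ
    src   : Fin p → Fin n
    tgt   : Fin p → Fin n
    mult  : Fin p → ℕ
    noLoop   : ∀ i → src i ≢ tgt i
    multPos  : ∀ i → 1 ≤ mult i
    bundleDistinct : ∀ i j →
      ((src i ≡ src j × tgt i ≡ tgt j) ⊎ (src i ≡ tgt j × tgt i ≡ src j)) → i ≡ j

module _ (G : Graph) where
  open Graph G

  Edge : Set
  Edge = Σ (Fin p) (λ i → Fin (mult i))

  Joins : Fin p → Fin n → Fin n → Set
  Joins i u w = (src i ≡ u × tgt i ≡ w) ⊎ (src i ≡ w × tgt i ≡ u)

  size : ℕ
  size = n + sumℕ p mult

  cst : ℕ
  cst = size * size

  record Subgraph : Set where
    field
      V : Fin n → Bool
      E : (i : Fin p) → Fin (mult i) → Bool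
      closed : ∀ i k → E i k ≡ true → V (src i) ≡ true × V (tgt i) ≡ true
  open Subgraph public

  full : Subgraph
  full = record { V = λ _ → true ; E = λ _ _ → true ; closed = λ _ _ _ → refl , refl }

  _≈_ : Subgraph → Subgraph → Set
  s ≈ t = (∀ v → V s v ≡ V t v) × (∀ i k → E s i k ≡ E t i k)

  _⊆_ : Subgraph → Subgraph → Set
  s ⊆ t = (∀ v → V s v ≡ true → V t v ≡ true) × (∀ i k → E s i k ≡ true → E t i k ≡ true)

  _∩_ : Subgraph → Subgraph → Subgraph
  s ∩ t = record
    { V = λ v → V s v ∧ V t v
    ; E = λ i k → E s i k ∧ E t i k
    ; closed = λ i k h →
        let hs = closed s i k (proj₁ (split (E s i k) (E t i k) h))
            ht = closed t i k (proj₂ (split (E s i k) (E t i k) h))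
        in helper (proj₁ hs) (proj₁ ht) , helper (proj₂ hs) (proj₂ ht)
    }
    where
      helper : ∀ {x y} → x ≡ true → y ≡ true → (x ∧ y) ≡ true
      helper refl refl = refl
      split : ∀ x y → (x ∧ y) ≡ true → x ≡ true × y ≡ true
      split true true _ = refl , refl
      split true false ()
      split false _ ()

  data Reach (t : Subgraph) : Fin n → Fin n → Set where
    here : ∀ {u} → Reach t u u
    step : ∀ {u w v} (i : Fin p) (k : Fin (mult i)) →
           E t i k ≡ true → Joins i u w → Reach t w v → Reach t u v

  Connected : Subgraph → Set
  Connected t = (∃ λ v → V t v ≡ true) ×
                (∀ u v → V t u ≡ true → V t v ≡ true → Reach t u v)

  IsTube : Subgraph → Set
  IsTube t = Connected t × ¬ (t ≈ full) ×
    (∀ i u w → V t u ≡ true → V t w ≡ true → Joins i u w →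
       ∃ λ (k : Fin (mult i)) → E t i k ≡ true)

  _⊂_ : Subgraph → Subgraph → Set
  s ⊂ t = s ⊆ t × ¬ (s ≈ t)

  Disjoint : Subgraph → Subgraph → Set
  Disjoint s t = ∀ v → ¬ (V s v ≡ true × V t v ≡ true)

  JoinedByEdge : Subgraph → Subgraph → Set
  JoinedByEdge s t = ∃ λ i → ∃ λ u → ∃ λ w → Joins i u w × V s u ≡ true × V t w ≡ true

  Compatible : Subgraph → Subgraph → Set
  Compatible s t = s ⊂ t ⊎ t ⊂ s ⊎ (Disjoint s t × ¬ JoinedByEdge s t)

  Adjacent : Subgraph → Subgraph → Set
  Adjacent s t = Disjoint s t × JoinedByEdge s t

  ProperlyIntersecting : Subgraph → Subgraph → Set
  ProperlyIntersecting s t = (∃ λ v → V s v ≡ true × V t v ≡ true) × ¬ (s ⊆ t) × ¬ (t ⊆ s)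

  IsComponentOf : Subgraph → Subgraph → Set
  IsComponentOf K H = K ⊆ H × Connected K ×
    (∀ i k → E H i k ≡ true → (V K (src i) ≡ true ⊎ V K (tgt i) ≡ true) → E K i k ≡ true)

  _∈_ : Subgraph → List Subgraph → Set
  t ∈ T = Any (t ≈_) T

  IsTubing : List Subgraph → Set
  IsTubing T = All IsTube T × AllPairs Compatible T ×
               ¬ (∀ K → IsComponentOf K full → K ∈ T)

  IsMaximalTubing : List Subgraph → Set
  IsMaximalTubing T = IsTubing T ×
    (∀ T' → IsTubing T' → (∀ t → t ∈ T → t ∈ T') → ∀ t → t ∈ T' → t ∈ T)

  BundleCompatible : Subgraph → Subgraph → Set
  BundleCompatible s t = ∀ i →
    (∀ k → E s i k ≡ true → E t i k ≡ true) ⊎ (∀ k → E t i k ≡ true → E s i k ≡ true)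

  IsMinimalTubeContaining : Subgraph → Subgraph → Subgraph → Set
  IsMinimalTubeContaining s t v = IsTube v × s ⊆ v × t ⊆ v ×
    (∀ u → IsTube u → s ⊆ u → t ⊆ u → u ⊆ v → u ≈ v)

  nodesOf : Subgraph → ℕ
  nodesOf t = count n (V t)

  edgesOf : Subgraph → Fin p → ℕ
  edgesOf t i = count (mult i) (E t i)

  outside : Subgraph → ℕ
  outside t = count n (λ v → not (V t v)) + sumℕ p (λ i → count (mult i) (λ k → not (E t i k)))

  Λ : Subgraph → ℕ
  Λ t = cst ^ nodesOf t + sumℕ p (λ i → cst ^ edgesOf t i) + outside t * outside t

  countL : List Subgraph → (Subgraph → Bool) → ℕ
  countL []      P = 0
  countL (t ∷ T) P = (if P t then 1 else 0) + countL T P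

  notContaining : List Subgraph → (i : Fin p) → Fin (mult i) → ℕ
  notContaining T i k = countL T (λ t → not (E t i k))

  -- an ordering e(i,1),…,e(i,b_i) of each bundle (0-based: position x ↦ ord i x),
  -- by increasing number of tubes of T not containing them
  IsBundleOrdering : List Subgraph → ((i : Fin p) → Fin (mult i) → Fin (mult i)) → Set
  IsBundleOrdering T ord = (∀ i → Bijective _≡_ _≡_ (ord i)) ×
    (∀ i (x y : Fin (mult i)) → x Fin.< y →
       notContaining T i (ord i x) ≤ notContaining T i (ord i y))

  IsLargestSeparating : List Subgraph → (i : Fin p) → Fin (mult i) → Fin (mult i) → Subgraph → Set
  IsLargestSeparating T i k k' t = t ∈ T × E t i k ≡ true × E t i k' ≡ false ×
    (∀ u → u ∈ T → E u i k ≡ true → E u i k' ≡ false → u ⊆ t)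

  -- Lg i x (0-based x, with x+1 < b_i) is G_{e(i,x+1)} of the paper (1-based)
  IsSeparatingFamily : List Subgraph → ((i : Fin p) → Fin (mult i) → Fin (mult i)) →
                       ((i : Fin p) → ℕ → Subgraph) → Set
  IsSeparatingFamily T ord Lg = ∀ i (x : ℕ) (h : suc x < mult i) →
    IsLargestSeparating T i (ord i (fromℕ< (<⇒≤ h))) (ord i (fromℕ< h)) (Lg i x)

  gap : Subgraph → ℤ
  gap t = + (2 * outside t) ℤ.- + 1

  -- f_T at 0-based position x of bundle i
  fpos : ((i : Fin p) → ℕ → Subgraph) → (i : Fin p) → ℕ → ℤ
  fpos Lg i zero    = + cst ℤ.+ sumℤ (mult i ∸ 1) (λ x → gap (Lg i (toℕ x)))
  fpos Lg i (suc x) = (+ (cst ^ suc x) ℤ.* (+ cst ℤ.- + 1)) ℤ.- gap (Lg i x)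

  inEvee : Subgraph → Subgraph → Subgraph → (i : Fin p) → Fin (mult i) → Bool
  inEvee s t v i k = E v i k ∧ not (E s i k) ∧ not (E t i k)

  sumF : ((i : Fin p) → Fin (mult i) → Fin (mult i)) → ((i : Fin p) → ℕ → Subgraph) →
         Subgraph → Subgraph → Subgraph → ℤ
  sumF ord Lg s t v = sumℤ p (λ i → sumℤ (mult i) (λ x →
    if inEvee s t v i (ord i x) then fpos Lg i (toℕ x) else + 0))

  sumΛ : List Subgraph → ℤ
  sumΛ []      = + 0
  sumΛ (w ∷ W) = + Λ w ℤ.+ sumΛ W

module Submission where

-- The proof splits on whether the node sets of a and b are nested.
--
-- * Nested node sets.  Then a and b properly intersect, a ∪ b is a tube, so
--   a ∪ b = v by minimality and E∨ is empty; a ∩ b is connected, so W = [a ∩ b].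
--   The exchange identity Λ(a ∪ b) + Λ(a ∩ b) = Λ(a) + Λ(b) + 2·|a∖b|·|b∖a|
--   (from bundle compatibility) then gives the strict inequality.
--
-- * Non-nested node sets.  Then |V(v)| > |V(a)|, |V(b)| and |G| ≥ 3, so the
--   single term c^|V(v)| outweighs all node and "outside" terms of Λ(a), Λ(b)
--   and all the lower order parts of f_T.  The edge terms are handled bundle by
--   bundle: the edges of v in a bundle form an initial segment of the ordering
--   of that bundle (a consequence of the compatibility of the tubes of T), and
--   a geometric series estimate on initial segments together with the exchange
--   identity for nested edge sets and the fact that a bundle's edges in a ∩ b
--   lie in a single component of a ∩ b bounds them.
--
-- The estimates only use that 2|G − G_e| − 1 lies between −1 and 2|G|.

open import Defs

module Proof where

  open import Data.Nat as ℕ using (ℕ; zero; suc; _+_; _*_; _∸_; _^_; _≤_; _<_; z≤n; s≤s)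
  open import Data.Nat.Properties
  open import Data.Nat.Tactic.RingSolver using (solve-∀)
  open import Data.Integer as ℤ using (ℤ; +≤+; +<+)
  import Data.Integer.Properties as ℤP
  import Data.Integer.Tactic.RingSolver as ℤSolver
  open import Data.Fin as Fin using (Fin; toℕ)
  open import Data.Fin.Properties using (toℕ-injective)
  open import Data.Fin.Permutation using (permutation)
  open import Data.Bool using (Bool; true; false; _∧_; _∨_; not; if_then_else_)
  open import Data.Bool.Properties using (∧-comm; ∨-comm; ∧-identityʳ)
  open import Data.List using (List; []; _∷_)
  open import Data.List.Relation.Unary.All using (All; []; _∷_)
  open import Data.List.Relation.Unary.Any using (here; there)
  open import Data.List.Relation.Unary.AllPairs using (AllPairs; []; _∷_)
  open import Data.Product using (_×_; _,_; ∃; proj₁; proj₂)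
  open import Data.Sum using (_⊎_; inj₁; inj₂; [_,_]′)
  open import Data.Empty using (⊥; ⊥-elim)
  open import Relation.Nullary using (¬_; yes; no)
  open import Relation.Nullary.Decidable using (⌊_⌋)
  open import Relation.Binary.PropositionalEquality hiding ([_])
  open import Function.Bundles using (_⇔_; Equivalence)
  open import Function.Definitions using (Bijective)
  import Algebra.Properties.CommutativeMonoid.Sum as MonoidSum

  ∧-intro : ∀ {x y} → x ≡ true → y ≡ true → (x ∧ y) ≡ true
  ∧-intro refl refl = refl

  ∧-elim : ∀ x y → (x ∧ y) ≡ true → x ≡ true × y ≡ true
  ∧-elim true true _ = refl , refl

  ∨-introˡ : ∀ x y → x ≡ true → (x ∨ y) ≡ true
  ∨-introˡ true y _ = refl

  ∨-introʳ : ∀ x y → y ≡ true → (x ∨ y) ≡ true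
  ∨-introʳ true  y _ = refl
  ∨-introʳ false y h = h

  ∨-elim : ∀ x y → (x ∨ y) ≡ true → x ≡ true ⊎ y ≡ true
  ∨-elim true  y _ = inj₁ refl
  ∨-elim false y h = inj₂ h

  bool-ext : ∀ x y → (x ≡ true → y ≡ true) → (y ≡ true → x ≡ true) → x ≡ y
  bool-ext false false _ _ = refl
  bool-ext false true  _ g = g refl
  bool-ext true  y     f _ = sym (f refl)

  ∧-not≡false⇒ : ∀ x y → x ≡ true → (x ∧ not y) ≡ false → y ≡ true
  ∧-not≡false⇒ true true _ _ = refl

  [_] : Bool → ℕ
  [ b ] = if b then 1 else 0

  sum-cong : ∀ m {f g : Fin m → ℕ} → (∀ x → f x ≡ g x) → sumℕ m f ≡ sumℕ m g
  sum-cong zero    h = refl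
  sum-cong (suc m) h = cong₂ _+_ (h Fin.zero) (sum-cong m (λ x → h (Fin.suc x)))

  sum-mono : ∀ m {f g : Fin m → ℕ} → (∀ x → f x ≤ g x) → sumℕ m f ≤ sumℕ m g
  sum-mono zero    h = z≤n
  sum-mono (suc m) h = +-mono-≤ (h Fin.zero) (sum-mono m (λ x → h (Fin.suc x)))

  sum-const : ∀ m k → sumℕ m (λ _ → k) ≡ m * k
  sum-const zero    k = refl
  sum-const (suc m) k = cong (k +_) (sum-const m k)

  sum-*ˡ : ∀ m k (f : Fin m → ℕ) → sumℕ m (λ x → k * f x) ≡ k * sumℕ m f
  sum-*ˡ zero    k f = sym (*-zeroʳ k)
  sum-*ˡ (suc m) k f =
    trans (cong (k * f Fin.zero +_) (sum-*ˡ m k (λ x → f (Fin.suc x))))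
          (sym (*-distribˡ-+ k (f Fin.zero) _))

  term≤sum : ∀ m (f : Fin m → ℕ) x → f x ≤ sumℕ m f
  term≤sum (suc m) f Fin.zero    = m≤m+n _ _
  term≤sum (suc m) f (Fin.suc x) = ≤-trans (term≤sum m _ x) (m≤n+m _ _)

  sum≡0⇒ : ∀ m (f : Fin m → ℕ) → sumℕ m f ≡ 0 → ∀ x → f x ≡ 0
  sum≡0⇒ (suc m) f h Fin.zero    = m+n≡0⇒m≡0 (f Fin.zero) h
  sum≡0⇒ (suc m) f h (Fin.suc x) = sum≡0⇒ m _ (m+n≡0⇒n≡0 (f Fin.zero) h) x

  -- sumℕ agrees with the library's summation over the monoid (ℕ, +, 0), which
  -- provides distributivity over + and invariance under permutations.
  module ℕSum = MonoidSum +-0-commutativeMonoid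

  sumℕ≡∑ : ∀ m (f : Fin m → ℕ) → sumℕ m f ≡ ℕSum.sum f
  sumℕ≡∑ zero    f = refl
  sumℕ≡∑ (suc m) f = cong (f Fin.zero +_) (sumℕ≡∑ m _)

  sum-+ : ∀ m (f g : Fin m → ℕ) → sumℕ m (λ x → f x + g x) ≡ sumℕ m f + sumℕ m g
  sum-+ m f g = begin
    sumℕ m (λ x → f x + g x)    ≡⟨ sumℕ≡∑ m _ ⟩
    ℕSum.sum (λ x → f x + g x)  ≡⟨ ℕSum.∑-distrib-+ f g ⟩
    ℕSum.sum f + ℕSum.sum g     ≡⟨ sym (cong₂ _+_ (sumℕ≡∑ m f) (sumℕ≡∑ m g)) ⟩
    sumℕ m f + sumℕ m g         ∎
    where open ≡-Reasoning

  sum-permute : ∀ m (σ : Fin m → Fin m) → Bijective _≡_ _≡_ σ → (f : Fin m → ℕ) →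
    sumℕ m (λ x → f (σ x)) ≡ sumℕ m f
  sum-permute m σ (σ-injective , σ-surjective) f = begin
    sumℕ m (λ x → f (σ x))  ≡⟨ sumℕ≡∑ m _ ⟩
    ℕSum.sum (λ x → f (σ x)) ≡⟨ sym (ℕSum.sum-permute f π) ⟩
    ℕSum.sum f               ≡⟨ sym (sumℕ≡∑ m f) ⟩
    sumℕ m f                 ∎
    where
    open ≡-Reasoning
    σ⁻¹ : Fin m → Fin m
    σ⁻¹ y = proj₁ (σ-surjective y)
    σσ⁻¹ : ∀ y → σ (σ⁻¹ y) ≡ y
    σσ⁻¹ y = proj₂ (σ-surjective y) refl
    π = permutation σ σ⁻¹ σσ⁻¹ (λ x → σ-injective (σσ⁻¹ (σ x)))

  []≤1 : ∀ b → [ b ] ≤ 1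
  []≤1 false = z≤n
  []≤1 true  = ≤-refl

  count≤ : ∀ m (P : Fin m → Bool) → count m P ≤ m
  count≤ m P = ≤-trans (sum-mono m (λ x → []≤1 (P x)))
                       (≤-reflexive (trans (sum-const m 1) (*-identityʳ m)))

  count-cong : ∀ m (P Q : Fin m → Bool) → (∀ x → P x ≡ Q x) → count m P ≡ count m Q
  count-cong m P Q h = sum-cong m (λ x → cong [_] (h x))

  count-mono : ∀ m (P Q : Fin m → Bool) → (∀ x → P x ≡ true → Q x ≡ true) → count m P ≤ count m Q
  count-mono m P Q h = sum-mono m (λ x → []-mono (P x) (Q x) (h x))
    where
    []-mono : ∀ p q → (p ≡ true → q ≡ true) → [ p ] ≤ [ q ]
    []-mono false q _ = z≤n
    []-mono true  q h rewrite h refl = ≤-refl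

  count-pos : ∀ m (P : Fin m → Bool) x → P x ≡ true → 1 ≤ count m P
  count-pos m P x h = ≤-trans (≤-reflexive (cong [_] (sym h))) (term≤sum m (λ y → [ P y ]) x)

  count≡0⇒ : ∀ m (P : Fin m → Bool) → count m P ≡ 0 → ∀ x → P x ≡ false
  count≡0⇒ m P h x = [b]≡0⇒ (P x) (sum≡0⇒ m _ h x)
    where
    [b]≡0⇒ : ∀ b → [ b ] ≡ 0 → b ≡ false
    [b]≡0⇒ false _ = refl

  sum-none : ∀ m (P : Fin m → Bool) (g : Fin m → ℕ) → (∀ x → P x ≡ false) →
    sumℕ m (λ x → if P x then g x else 0) ≡ 0
  sum-none m P g h = trans (sum-cong m (λ x → cong (λ b → if b then g x else 0) (h x)))
                           (trans (sum-const m 0) (*-zeroʳ m))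

  count-additive : ∀ m (P Q R : Fin m → Bool) → (∀ x → [ P x ] ≡ [ Q x ] + [ R x ]) →
    count m P ≡ count m Q + count m R
  count-additive m P Q R h = trans (sum-cong m h) (sum-+ m _ _)

  count-permute : ∀ m (σ : Fin m → Fin m) → Bijective _≡_ _≡_ σ → (P : Fin m → Bool) →
    count m (λ x → P (σ x)) ≡ count m P
  count-permute m σ σ-bijective P = sum-permute m σ σ-bijective (λ x → [ P x ])

  none-or-witness : ∀ m (P : Fin m → Bool) → (∀ x → P x ≡ false) ⊎ ∃ λ x → P x ≡ true
  none-or-witness zero    P = inj₁ (λ ())
  none-or-witness (suc m) P with P Fin.zero in P₀ | none-or-witness m (λ x → P (Fin.suc x))
  ... | true  | _            = inj₂ (Fin.zero , P₀)
  ... | false | inj₂ (x , h) = inj₂ (Fin.suc x , h)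
  ... | false | inj₁ h       = inj₁ λ { Fin.zero → P₀ ; (Fin.suc x) → h x }

  inclusion-or-witness : ∀ m (P Q : Fin m → Bool) →
    (∀ x → P x ≡ true → Q x ≡ true) ⊎ ∃ λ x → (P x ∧ not (Q x)) ≡ true
  inclusion-or-witness m P Q with none-or-witness m (λ x → P x ∧ not (Q x))
  ... | inj₁ none    = inj₁ (λ x h → ∧-not≡false⇒ _ _ h (none x))
  ... | inj₂ witness = inj₂ witness

  -- Give position x of Fin m the weight c^x (c − 1).  If V is
  -- an initial segment and Y, S ⊆ V are disjoint, then c^|Y| plus the weights of
  -- S is at most c^|V| (the weights of the first k positions sum to c^k − 1).

  IsInitialSegment : ∀ m → (Fin m → Bool) → Set
  IsInitialSegment m V = ∀ x y → toℕ x ≤ toℕ y → V y ≡ true → V x ≡ true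

  weight : ℕ → ℕ → ℕ
  weight c j = c ^ j * (c ∸ 1)

  weightOf : ℕ → ∀ m → (Fin m → Bool) → ℕ
  weightOf c m S = sumℕ m (λ x → if S x then weight c (toℕ x) else 0)

  weightOf-suc : ∀ c m (S : Fin (suc m) → Bool) →
    sumℕ m (λ x → if S (Fin.suc x) then weight c (suc (toℕ x)) else 0)
      ≡ c * weightOf c m (λ x → S (Fin.suc x))
  weightOf-suc c m S = trans (sum-cong m (λ x → shift (S (Fin.suc x)) (toℕ x))) (sum-*ˡ m c _)
    where
    shift : ∀ b j → (if b then weight c (suc j) else 0) ≡ c * (if b then weight c j else 0)
    shift true  j = *-assoc c (c ^ j) (c ∸ 1)
    shift false j = sym (*-zeroʳ c)

  extend-bound : ∀ c .{{_ : ℕ.NonZero c}} (y w v : ℕ) (y₀ s₀ : Bool) → (s₀ ≡ true → y₀ ≡ false) →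
    c ^ y + w ≤ c ^ v → c ^ ([ y₀ ] + y) + ((if s₀ then weight c 0 else 0) + c * w) ≤ c ^ (1 + v)
  extend-bound c y w v true  true  s⇒¬y _ with s⇒¬y refl
  ... | ()
  extend-bound c y w v true  false _ tail = begin
    c * c ^ y + c * w  ≡⟨ sym (*-distribˡ-+ c _ w) ⟩
    c * (c ^ y + w)    ≤⟨ *-monoʳ-≤ c tail ⟩
    c * c ^ v          ∎
    where open ≤-Reasoning
  extend-bound c y w v false true  _ tail = begin
    c ^ y + (1 * (c ∸ 1) + c * w)      ≡⟨ cong (λ z → c ^ y + (z + c * w)) (*-identityˡ (c ∸ 1)) ⟩
    c ^ y + (c ∸ 1 + c * w)            ≡⟨ sym (+-assoc (c ^ y) (c ∸ 1) (c * w)) ⟩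
    (c ^ y + (c ∸ 1)) + c * w          ≤⟨ +-monoˡ-≤ (c * w) (+-monoʳ-≤ (c ^ y) (m≤m*n (c ∸ 1) (c ^ y) {{m^n≢0 c y}})) ⟩
    (c ^ y + (c ∸ 1) * c ^ y) + c * w  ≡⟨ cong (_+ c * w) c^y+[c-1]c^y ⟩
    c * c ^ y + c * w                  ≡⟨ sym (*-distribˡ-+ c _ w) ⟩
    c * (c ^ y + w)                    ≤⟨ *-monoʳ-≤ c tail ⟩
    c * c ^ v                          ∎
    where
    open ≤-Reasoning
    c^y+[c-1]c^y : c ^ y + (c ∸ 1) * c ^ y ≡ c * c ^ y
    c^y+[c-1]c^y = cong (_* c ^ y) (m+[n∸m]≡n (ℕ.>-nonZero⁻¹ c))
  extend-bound c y w v false false _ tail = begin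
    c ^ y + c * w      ≤⟨ +-monoˡ-≤ (c * w) (m≤n*m (c ^ y) c) ⟩
    c * c ^ y + c * w  ≡⟨ sym (*-distribˡ-+ c _ w) ⟩
    c * (c ^ y + w)    ≤⟨ *-monoʳ-≤ c tail ⟩
    c * c ^ v          ∎
    where open ≤-Reasoning

  initial-segment-bound : ∀ c .{{_ : ℕ.NonZero c}} m (V Y S : Fin m → Bool) →
    IsInitialSegment m V → (∀ x → Y x ≡ true → V x ≡ true) →
    (∀ x → S x ≡ true → V x ≡ true) → (∀ x → S x ≡ true → Y x ≡ false) →
    c ^ count m Y + weightOf c m S ≤ c ^ count m V
  initial-segment-bound c zero V Y S _ _ _ _ = ≤-refl
  initial-segment-bound c (suc m) V Y S V-init YV SV SY with V Fin.zero in V₀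
  ... | false = begin
      c ^ count (suc m) Y + weightOf c (suc m) S
    ≡⟨ cong₂ (λ y s → c ^ y + s) (sum-none (suc m) Y (λ _ → 1) (λ x → empty YV x))
                                 (sum-none (suc m) S (λ x → weight c (toℕ x)) (λ x → empty SV x)) ⟩
      1 + 0
    ≤⟨ m^n>0 c (count m (λ x → V (Fin.suc x))) ⟩
      c ^ count m (λ x → V (Fin.suc x))
    ∎
    where
    open ≤-Reasoning
    -- an initial segment missing position 0 is empty
    empty : ∀ {P : Fin (suc m) → Bool} → (∀ x → P x ≡ true → V x ≡ true) → ∀ x → P x ≡ false
    empty {P} PV x with P x in Px
    ... | false = refl
    ... | true  with trans (sym V₀) (V-init Fin.zero x z≤n (PV x Px))
    ... | ()
  ... | true = begin
      c ^ count (suc m) Y + (S₀-weight + sumℕ m (λ x → if S (Fin.suc x) then weight c (suc (toℕ x)) else 0))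
    ≡⟨ cong (λ z → c ^ count (suc m) Y + (S₀-weight + z)) (weightOf-suc c m S) ⟩
      c ^ count (suc m) Y + (S₀-weight + c * weightOf c m (λ x → S (Fin.suc x)))
    ≤⟨ extend-bound c _ _ (count m (λ x → V (Fin.suc x))) (Y Fin.zero) (S Fin.zero) (SY Fin.zero) tail ⟩
      c ^ (1 + count m (λ x → V (Fin.suc x)))
    ∎
    where
    open ≤-Reasoning
    S₀-weight = if S Fin.zero then weight c 0 else 0
    tail = initial-segment-bound c m (λ x → V (Fin.suc x)) (λ x → Y (Fin.suc x)) (λ x → S (Fin.suc x))
             (λ x y x≤y → V-init (Fin.suc x) (Fin.suc y) (s≤s x≤y))
             (λ x → YV (Fin.suc x)) (λ x → SV (Fin.suc x)) (λ x → SY (Fin.suc x))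

  -- Exchange for nested sets: if P ⊆ Q or Q ⊆ P then P ∪ Q and P ∩ Q are Q and P
  -- in some order, so  c^|P ∪ Q| + c^|P ∩ Q| = c^|P| + c^|Q|.
  Nested : ∀ {m} → (Fin m → Bool) → (Fin m → Bool) → Set
  Nested P Q = (∀ x → P x ≡ true → Q x ≡ true) ⊎ (∀ x → Q x ≡ true → P x ≡ true)

  exchange : ∀ m c (P Q : Fin m → Bool) → Nested P Q →
    c ^ count m (λ x → P x ∨ Q x) + c ^ count m (λ x → P x ∧ Q x) ≡ c ^ count m P + c ^ count m Q
  exchange m c P Q (inj₁ P⊆Q) =
    trans (cong₂ (λ s t → c ^ s + c ^ t) (count-cong m _ _ (λ x → ∨-of-⊆ (P x) (Q x) (P⊆Q x)))
                                         (count-cong m _ _ (λ x → ∧-of-⊆ (P x) (Q x) (P⊆Q x))))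
          (+-comm (c ^ count m Q) (c ^ count m P))
    where
    ∨-of-⊆ : ∀ x y → (x ≡ true → y ≡ true) → (x ∨ y) ≡ y
    ∨-of-⊆ false y _ = refl
    ∨-of-⊆ true  y h = sym (h refl)
    ∧-of-⊆ : ∀ x y → (x ≡ true → y ≡ true) → (x ∧ y) ≡ x
    ∧-of-⊆ false y _ = refl
    ∧-of-⊆ true  y h = h refl
  exchange m c P Q (inj₂ Q⊆P) =
    trans (cong₂ (λ s t → c ^ s + c ^ t) (count-cong m _ _ (λ x → ∨-comm (P x) (Q x)))
                                         (count-cong m _ _ (λ x → ∧-comm (P x) (Q x))))
          (trans (exchange m c Q P (inj₁ Q⊆P)) (+-comm (c ^ count m Q) (c ^ count m P)))

  -- Saturation: iterating an inflationary operator F on subsets of Fin m reaches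
  -- a closed set (F R ⊆ R) after m + 1 steps, since until then every step adds
  -- an element.
  module Saturation {m : ℕ} (F : (Fin m → Bool) → Fin m → Bool)
      (F-cong : ∀ R R' → (∀ x → R x ≡ R' x) → ∀ x → F R x ≡ F R' x)
      (F-inflationary : ∀ R x → R x ≡ true → F R x ≡ true)
      (R₀ : Fin m → Bool) where

    iterate : ℕ → Fin m → Bool
    iterate zero    = R₀
    iterate (suc j) = F (iterate j)

    Closed : (Fin m → Bool) → Set
    Closed R = ∀ x → F R x ≡ true → R x ≡ true

    iterate-mono : ∀ j k x → j ≤ k → iterate j x ≡ true → iterate k x ≡ true
    iterate-mono j zero    x z≤n h = h
    iterate-mono j (suc k) x j≤k h with m≤n⇒m<n∨m≡n j≤k
    ... | inj₂ refl = h
    ... | inj₁ j<k  = F-inflationary (iterate k) x (iterate-mono j k x (≤-pred j<k) h)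

    closed-suc : ∀ j → Closed (iterate j) → Closed (iterate (suc j))
    closed-suc j cl x h = F-inflationary _ x (cl x (trans (sym (F-cong _ _ same x)) h))
      where
      same : ∀ x → iterate (suc j) x ≡ iterate j x
      same x = bool-ext _ _ (cl x) (F-inflationary _ x)

    grows-or-closed : ∀ j → j ≤ count m (iterate j) ⊎ Closed (iterate j)
    grows-or-closed zero = inj₁ z≤n
    grows-or-closed (suc j) with count m (λ x → iterate (suc j) x ∧ not (iterate j x)) in new
    ... | zero = inj₂ (closed-suc j iterate-j-closed)
      where
      iterate-j-closed : Closed (iterate j)
      iterate-j-closed x h = ∧-not≡false⇒ _ _ h (count≡0⇒ m _ new x)
    ... | suc k with grows-or-closed j
    ...   | inj₂ cl = inj₂ (closed-suc j cl)
    ...   | inj₁ j≤ = inj₁ (begin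
            suc j                                ≡⟨ +-comm 1 j ⟩
            j + 1                                ≤⟨ +-mono-≤ j≤ (s≤s z≤n) ⟩
            count m (iterate j) + suc k          ≡⟨ cong (count m (iterate j) +_) (sym new) ⟩
            count m (iterate j) + count m added  ≡⟨ sym (count-additive m _ _ _ (λ x → split (iterate j x) _ (F-inflationary _ x))) ⟩
            count m (iterate (suc j))            ∎)
      where
      open ≤-Reasoning
      added = λ x → iterate (suc j) x ∧ not (iterate j x)
      split : ∀ r s → (r ≡ true → s ≡ true) → [ s ] ≡ [ r ] + [ s ∧ not r ]
      split false false _ = refl
      split false true  _ = refl
      split true  s     h rewrite h refl = refl

    saturated : Fin m → Bool
    saturated = iterate (suc m)

    saturated-closed : Closed saturated
    saturated-closed with grows-or-closed (suc m)
    ... | inj₁ m<count = ⊥-elim (<⇒≱ m<count (count≤ m _))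
    ... | inj₂ cl = cl

  -- Boolean "some element of Fin m satisfies P", and boolean equality on Fin m;
  -- they let the construction of components be carried out by computation.
  anyF : ∀ m → (Fin m → Bool) → Bool
  anyF zero    P = false
  anyF (suc m) P = P Fin.zero ∨ anyF m (λ x → P (Fin.suc x))

  anyF-intro : ∀ m (P : Fin m → Bool) x → P x ≡ true → anyF m P ≡ true
  anyF-intro (suc m) P Fin.zero    h = ∨-introˡ _ _ h
  anyF-intro (suc m) P (Fin.suc x) h = ∨-introʳ (P Fin.zero) _ (anyF-intro m _ x h)

  anyF-elim : ∀ m (P : Fin m → Bool) → anyF m P ≡ true → ∃ λ x → P x ≡ true
  anyF-elim (suc m) P h with ∨-elim (P Fin.zero) _ h
  ... | inj₁ h₀ = Fin.zero , h₀
  ... | inj₂ hs = let (x , hx) = anyF-elim m _ hs in Fin.suc x , hx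

  anyF-cong : ∀ m (P Q : Fin m → Bool) → (∀ x → P x ≡ Q x) → anyF m P ≡ anyF m Q
  anyF-cong zero    P Q h = refl
  anyF-cong (suc m) P Q h = cong₂ _∨_ (h Fin.zero) (anyF-cong m _ _ (λ x → h (Fin.suc x)))

  eqF : ∀ {m} → Fin m → Fin m → Bool
  eqF x y = ⌊ x Fin.≟ y ⌋

  eqF-refl : ∀ {m} (x : Fin m) → eqF x x ≡ true
  eqF-refl x with x Fin.≟ x
  ... | yes _  = refl
  ... | no x≢x = ⊥-elim (x≢x refl)

  eqF-elim : ∀ {m} (x y : Fin m) → eqF x y ≡ true → x ≡ y
  eqF-elim x y h with x Fin.≟ y
  ... | yes x≡y = x≡y

  sumℤ-≤ : ∀ m (f : Fin m → ℤ) (g : Fin m → ℕ) → (∀ x → f x ℤ.≤ ℤ.+ g x) → sumℤ m f ℤ.≤ ℤ.+ sumℕ m g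
  sumℤ-≤ zero    f g h = +≤+ z≤n
  sumℤ-≤ (suc m) f g h = ℤP.≤-trans (ℤP.+-mono-≤ (h Fin.zero) (sumℤ-≤ m _ _ (λ x → h (Fin.suc x))))
                                    (ℤP.≤-reflexive (sym (ℤP.pos-+ (g Fin.zero) _)))

  sumℤ-zeros : ∀ m (f : Fin m → ℤ) → (∀ x → f x ≡ ℤ.+ 0) → sumℤ m f ≡ ℤ.+ 0
  sumℤ-zeros zero    f h = refl
  sumℤ-zeros (suc m) f h = cong₂ ℤ._+_ (h Fin.zero) (sumℤ-zeros m _ (λ x → h (Fin.suc x)))

  integer-form : ∀ (A B V W Fb : ℕ) (F : ℤ) → F ℤ.≤ ℤ.+ Fb → A + B + Fb < V + W →
    ℤ.+ A ℤ.< ((ℤ.+ V ℤ.- ℤ.+ B) ℤ.+ ℤ.+ W) ℤ.- F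
  integer-form A B V W Fb F F≤Fb lt with m≤n⇒∃[o]m+o≡n lt
  ... | r , eq = begin-strict
    ℤ.+ A                                   <⟨ +<+ (m<m+n A (s≤s z≤n)) ⟩
    ℤ.+ (A + suc r)                         ≡⟨ ℤP.pos-+ A (suc r) ⟩
    ℤ.+ A ℤ.+ ℤ.+ suc r                     ≡⟨ sym (cancel (ℤ.+ V) (ℤ.+ W) (ℤ.+ B) (ℤ.+ Fb) (ℤ.+ A) (ℤ.+ suc r) total) ⟩
    ((ℤ.+ V ℤ.- ℤ.+ B) ℤ.+ ℤ.+ W) ℤ.- ℤ.+ Fb ≤⟨ ℤP.+-monoʳ-≤ ((ℤ.+ V ℤ.- ℤ.+ B) ℤ.+ ℤ.+ W) (ℤP.neg-mono-≤ F≤Fb) ⟩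
    ((ℤ.+ V ℤ.- ℤ.+ B) ℤ.+ ℤ.+ W) ℤ.- F     ∎
    where
    open ℤP.≤-Reasoning
    total : ℤ.+ V ℤ.+ ℤ.+ W ≡ ((ℤ.+ A ℤ.+ ℤ.+ B) ℤ.+ ℤ.+ Fb) ℤ.+ ℤ.+ suc r
    total = begin-equality
      ℤ.+ V ℤ.+ ℤ.+ W                         ≡⟨ sym (ℤP.pos-+ V W) ⟩
      ℤ.+ (V + W)                             ≡⟨ cong ℤ.+_ (sym (trans (+-suc _ r) eq)) ⟩
      ℤ.+ (A + B + Fb + suc r)                ≡⟨ ℤP.pos-+ (A + B + Fb) (suc r) ⟩
      ℤ.+ (A + B + Fb) ℤ.+ ℤ.+ suc r          ≡⟨ cong (ℤ._+ ℤ.+ suc r) (trans (ℤP.pos-+ (A + B) Fb)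
                                                    (cong (ℤ._+ ℤ.+ Fb) (ℤP.pos-+ A B))) ⟩
      ((ℤ.+ A ℤ.+ ℤ.+ B) ℤ.+ ℤ.+ Fb) ℤ.+ ℤ.+ suc r ∎
    cancel : ∀ v w b f a s → v ℤ.+ w ≡ ((a ℤ.+ b) ℤ.+ f) ℤ.+ s → ((v ℤ.- b) ℤ.+ w) ℤ.- f ≡ a ℤ.+ s
    cancel v w b f a s vw = trans (reorder v w b f) (trans (cong (λ z → (z ℤ.- b) ℤ.- f) vw) (collapse a b f s))
      where
      reorder : ∀ v w b f → ((v ℤ.- b) ℤ.+ w) ℤ.- f ≡ ((v ℤ.+ w) ℤ.- b) ℤ.- f
      reorder = ℤSolver.solve-∀
      collapse : ∀ a b f s → ((((a ℤ.+ b) ℤ.+ f) ℤ.+ s) ℤ.- b) ℤ.- f ≡ a ℤ.+ s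
      collapse = ℤSolver.solve-∀

  small-sum< : ∀ c q x₁ x₂ x₃ x₄ x₅ x₆ g → 9 ≤ c → 1 ≤ q →
    x₁ ≤ q → x₂ ≤ q → x₃ ≤ q → x₄ ≤ q → x₅ ≤ q → x₆ ≤ q → g ≤ 2 * q →
    x₁ + x₂ + x₃ + x₄ + x₅ + x₆ + g < c * q
  small-sum< c q x₁ x₂ x₃ x₄ x₅ x₆ g 9≤c 1≤q h₁ h₂ h₃ h₄ h₅ h₆ h₇ = begin-strict
    x₁ + x₂ + x₃ + x₄ + x₅ + x₆ + g  ≤⟨ +-mono-≤ (+-mono-≤ (+-mono-≤ (+-mono-≤ (+-mono-≤ (+-mono-≤ h₁ h₂) h₃) h₄) h₅) h₆) h₇ ⟩
    q + q + q + q + q + q + 2 * q    ≡⟨ eight q ⟩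
    8 * q                            <⟨ *-monoˡ-< q {{ℕ.>-nonZero 1≤q}} (n<1+n 8) ⟩
    9 * q                            ≤⟨ *-monoˡ-≤ q 9≤c ⟩
    c * q                            ∎
    where
    open ≤-Reasoning
    eight : ∀ q → q + q + q + q + q + q + 2 * q ≡ 8 * q
    eight = solve-∀

  module _ (G : Graph) where
    open Graph G

    infix 4 _≈ᴳ_ _⊆ᴳ_
    infixl 6 _∩ᴳ_ _∪ᴳ_

    _≈ᴳ_ _⊆ᴳ_ : Subgraph G → Subgraph G → Set
    s ≈ᴳ t = _≈_ G s t
    s ⊆ᴳ t = _⊆_ G s t

    _∩ᴳ_ : Subgraph G → Subgraph G → Subgraph G
    s ∩ᴳ t = _∩_ G s t

    _∪ᴳ_ : Subgraph G → Subgraph G → Subgraph G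
    s ∪ᴳ t = record
      { V = λ w → V s w ∨ V t w
      ; E = λ i k → E s i k ∨ E t i k
      ; closed = λ i k h → ends i k (∨-elim (E s i k) _ h)
      }
      where
      ends : ∀ i k → E s i k ≡ true ⊎ E t i k ≡ true →
        (V s (src i) ∨ V t (src i)) ≡ true × (V s (tgt i) ∨ V t (tgt i)) ≡ true
      ends i k (inj₁ e) = ∨-introˡ _ _ (proj₁ (closed s i k e)) , ∨-introˡ _ _ (proj₂ (closed s i k e))
      ends i k (inj₂ e) = ∨-introʳ (V s (src i)) _ (proj₁ (closed t i k e)) ,
                          ∨-introʳ (V s (tgt i)) _ (proj₂ (closed t i k e))

    ≈-refl : ∀ {s} → s ≈ᴳ s
    ≈-refl = (λ _ → refl) , (λ _ _ → refl)

    ≈-sym : ∀ {s t} → s ≈ᴳ t → t ≈ᴳ s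
    ≈-sym (same-V , same-E) = (λ v → sym (same-V v)) , (λ i k → sym (same-E i k))

    ≈-trans : ∀ {s t u} → s ≈ᴳ t → t ≈ᴳ u → s ≈ᴳ u
    ≈-trans (V₁ , E₁) (V₂ , E₂) = (λ v → trans (V₁ v) (V₂ v)) , (λ i k → trans (E₁ i k) (E₂ i k))

    edgesOf-≈ : ∀ {s t} → s ≈ᴳ t → ∀ i → edgesOf G s i ≡ edgesOf G t i
    edgesOf-≈ (_ , same-E) i = count-cong (mult i) _ _ (same-E i)

    outside-≈ : ∀ {s t} → s ≈ᴳ t → outside G s ≡ outside G t
    outside-≈ (same-V , same-E) =
      cong₂ _+_ (count-cong n _ _ (λ v → cong not (same-V v)))
                (sum-cong p (λ i → count-cong (mult i) _ _ (λ k → cong not (same-E i k))))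

    Λ-≈ : ∀ {s t} → s ≈ᴳ t → Λ G s ≡ Λ G t
    Λ-≈ {s} {t} s≈t@(same-V , _) =
      cong₂ _+_ (cong₂ _+_ (cong (cst G ^_) (count-cong n _ _ same-V))
                           (sum-cong p (λ i → cong (cst G ^_) (edgesOf-≈ {s} {t} s≈t i))))
                (cong₂ _*_ (outside-≈ {s} {t} s≈t) (outside-≈ {s} {t} s≈t))

    Joins-sym : ∀ {i x y} → Joins G i x y → Joins G i y x
    Joins-sym (inj₁ (s≡x , t≡y)) = inj₂ (s≡x , t≡y)
    Joins-sym (inj₂ (s≡y , t≡x)) = inj₁ (s≡y , t≡x)

    Reach-trans : ∀ {t x y z} → Reach G t x y → Reach G t y z → Reach G t x z
    Reach-trans here               r = r
    Reach-trans (step i k e j r₁) r = step i k e j (Reach-trans r₁ r)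

    Reach-sym : ∀ {t x y} → Reach G t x y → Reach G t y x
    Reach-sym here             = here
    Reach-sym (step i k e j r) = Reach-trans (Reach-sym r) (step i k e (Joins-sym j) here)

    Reach-transfer : ∀ {s t} → (∀ i k → E s i k ≡ true → ∃ λ k' → E t i k' ≡ true) →
      ∀ {x y} → Reach G s x y → Reach G t x y
    Reach-transfer h here             = here
    Reach-transfer h (step i k e j r) = step i (proj₁ (h i k e)) (proj₂ (h i k e)) j (Reach-transfer h r)

    -- The connected component of a subgraph H through a node u of H: its nodes
    -- are the saturation of {u} under "add the other end of an edge of H", its
    -- edges are the edges of H starting there.
    module ComponentOf (H : Subgraph G) (u : Fin n) (u∈H : V H u ≡ true) where

      hasEdge : Fin p → Bool
      hasEdge i = anyF (mult i) (E H i)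

      leadsTo : (Fin n → Bool) → Fin n → Fin p → Bool
      leadsTo R w i = hasEdge i ∧ ((R (src i) ∧ eqF (tgt i) w) ∨ (R (tgt i) ∧ eqF (src i) w))

      grow : (Fin n → Bool) → Fin n → Bool
      grow R w = R w ∨ anyF p (leadsTo R w)

      grow-cong : ∀ R R' → (∀ w → R w ≡ R' w) → ∀ w → grow R w ≡ grow R' w
      grow-cong R R' h w = cong₂ _∨_ (h w) (anyF-cong p _ _ (λ i →
        cong (hasEdge i ∧_) (cong₂ _∨_ (cong (_∧ eqF (tgt i) w) (h (src i)))
                                       (cong (_∧ eqF (src i) w) (h (tgt i))))))

      open Saturation grow grow-cong (λ R w → ∨-introˡ (R w) _) (eqF u) public

      GrownFrom : (Fin n → Bool) → Fin n → Set
      GrownFrom R w = ∃ λ i → ∃ λ (k : Fin (mult i)) → E H i k ≡ true ×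
        ((R (src i) ≡ true × tgt i ≡ w) ⊎ (R (tgt i) ≡ true × src i ≡ w))

      grow-elim : ∀ R w → grow R w ≡ true → R w ≡ true ⊎ GrownFrom R w
      grow-elim R w h with ∨-elim (R w) _ h
      ... | inj₁ r = inj₁ r
      ... | inj₂ a with anyF-elim p _ a
      ... | i , b with ∧-elim (hasEdge i) _ b
      ... | he , c with anyF-elim (mult i) _ he | ∨-elim (R (src i) ∧ eqF (tgt i) w) _ c
      ... | k , ek | inj₁ d = let (r , e) = ∧-elim (R (src i)) _ d in inj₂ (i , k , ek , inj₁ (r , eqF-elim _ _ e))
      ... | k , ek | inj₂ d = let (r , e) = ∧-elim (R (tgt i)) _ d in inj₂ (i , k , ek , inj₂ (r , eqF-elim _ _ e))

      grow-tgt : ∀ R i k → E H i k ≡ true → R (src i) ≡ true → grow R (tgt i) ≡ true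
      grow-tgt R i k e r = ∨-introʳ (R (tgt i)) _ (anyF-intro p _ i
        (∧-intro (anyF-intro (mult i) _ k e) (∨-introˡ _ _ (∧-intro r (eqF-refl (tgt i))))))

      grow-src : ∀ R i k → E H i k ≡ true → R (tgt i) ≡ true → grow R (src i) ≡ true
      grow-src R i k e r = ∨-introʳ (R (src i)) _ (anyF-intro p _ i
        (∧-intro (anyF-intro (mult i) _ k e)
                 (∨-introʳ (R (src i) ∧ eqF (tgt i) (src i)) _ (∧-intro r (eqF-refl (src i))))))

      -- closedness of the saturation gives the other end of each of its edges
      component : Subgraph G
      component = record
        { V = saturated
        ; E = λ i k → E H i k ∧ saturated (src i)
        ; closed = λ i k h → let (e , r) = ∧-elim (E H i k) _ h in
                             r , saturated-closed (tgt i) (grow-tgt saturated i k e r)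
        }

      u∈component : V component u ≡ true
      u∈component = iterate-mono 0 (suc n) u z≤n (eqF-refl u)

      iterate⊆H : ∀ j w → iterate j w ≡ true → V H w ≡ true
      iterate⊆H zero    w h = subst (λ z → V H z ≡ true) (eqF-elim u w h) u∈H
      iterate⊆H (suc j) w h with grow-elim (iterate j) w h
      ... | inj₁ r = iterate⊆H j w r
      ... | inj₂ (i , k , e , inj₁ (_ , refl)) = proj₂ (closed H i k e)
      ... | inj₂ (i , k , e , inj₂ (_ , refl)) = proj₁ (closed H i k e)

      reaches-u : ∀ j → j ≤ suc n → ∀ w → iterate j w ≡ true → Reach G component w u
      reaches-u zero    _   w h = subst (λ z → Reach G component z u) (eqF-elim u w h) here
      reaches-u (suc j) j≤ w h with grow-elim (iterate j) w h
      ... | inj₁ r = reaches-u j (≤-trans (n≤1+n j) j≤) w r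
      ... | inj₂ (i , k , e , inj₁ (r , refl)) =
            step i k (∧-intro e (iterate-mono j (suc n) (src i) (≤-trans (n≤1+n j) j≤) r)) (inj₂ (refl , refl))
                 (reaches-u j (≤-trans (n≤1+n j) j≤) (src i) r)
      ... | inj₂ (i , k , e , inj₂ (r , refl)) =
            step i k (∧-intro e (iterate-mono (suc j) (suc n) (src i) j≤ h)) (inj₁ (refl , refl))
                 (reaches-u j (≤-trans (n≤1+n j) j≤) (tgt i) r)

      isComponent : IsComponentOf G component H
      isComponent =
          ((λ w → iterate⊆H (suc n) w) , (λ i k h → proj₁ (∧-elim (E H i k) _ h)))
        , ((u , u∈component) ,
           (λ x y hx hy → Reach-trans (reaches-u (suc n) ≤-refl x hx) (Reach-sym (reaches-u (suc n) ≤-refl y hy))))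
        , λ i k e → λ { (inj₁ s∈) → ∧-intro e s∈
                      ; (inj₂ t∈) → ∧-intro e (saturated-closed (src i) (grow-src saturated i k e t∈)) }

    compatible-member : ∀ v t T → _∈_ G v T → All (Compatible G t) T →
      ∃ λ u → v ≈ᴳ u × Compatible G t u
    compatible-member v t (u ∷ T) (here v≈u) (c ∷ _)  = u , v≈u , c
    compatible-member v t (u ∷ T) (there v∈) (_ ∷ cs) = compatible-member v t T v∈ cs

    -- Edges of a tube of a tubing form initial segments of the bundle orderings.
    -- If u ∈ T contains the edge f but not e of bundle i, every tube compatible
    -- with u that contains e also contains f (it cannot lie inside u, and being
    -- disjoint from u is impossible as e and f have the same ends).  Hence fewer
    -- tubes of T miss f than miss e, so f comes after e in the ordering.
    module _ (i : Fin p) (e f : Fin (mult i)) where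

      compatible-transfer : ∀ t u → E u i f ≡ true → E u i e ≡ false →
        Compatible G t u ⊎ Compatible G u t → E t i e ≡ true → E t i f ≡ true
      compatible-transfer t u f∈u e∉u t~u e∈t = by-cases (normalise t~u)
        where
        normalise : Compatible G t u ⊎ Compatible G u t → t ⊆ᴳ u ⊎ u ⊆ᴳ t ⊎ Disjoint G t u
        normalise (inj₁ (inj₁ (t⊆u , _)))          = inj₁ t⊆u
        normalise (inj₁ (inj₂ (inj₁ (u⊆t , _))))   = inj₂ (inj₁ u⊆t)
        normalise (inj₁ (inj₂ (inj₂ (t∥u , _))))   = inj₂ (inj₂ t∥u)
        normalise (inj₂ (inj₁ (u⊆t , _)))          = inj₂ (inj₁ u⊆t)
        normalise (inj₂ (inj₂ (inj₁ (t⊆u , _))))   = inj₁ t⊆u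
        normalise (inj₂ (inj₂ (inj₂ (u∥t , _))))   = inj₂ (inj₂ (λ w (w∈t , w∈u) → u∥t w (w∈u , w∈t)))
        by-cases : t ⊆ᴳ u ⊎ u ⊆ᴳ t ⊎ Disjoint G t u → E t i f ≡ true
        by-cases (inj₁ t⊆u) with trans (sym (proj₂ t⊆u i e e∈t)) e∉u
        ... | ()
        by-cases (inj₂ (inj₁ u⊆t)) = proj₂ u⊆t i f f∈u
        by-cases (inj₂ (inj₂ t∥u)) = ⊥-elim (t∥u (src i) (proj₁ (closed t i e e∈t) , proj₁ (closed u i f f∈u)))

      ¬-anti : ∀ x y → (x ≡ true → y ≡ true) → [ not y ] ≤ [ not x ]
      ¬-anti false y _ = []≤1 (not y)
      ¬-anti true  y h rewrite h refl = z≤n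

      missing-f≤missing-e : ∀ T → All (λ t → E t i e ≡ true → E t i f ≡ true) T →
        notContaining G T i f ≤ notContaining G T i e
      missing-f≤missing-e []      []       = z≤n
      missing-f≤missing-e (t ∷ T) (h ∷ hs) = +-mono-≤ (¬-anti (E t i e) (E t i f) h) (missing-f≤missing-e T hs)

      transfer-all : ∀ u T → E u i f ≡ true → E u i e ≡ false → All (Compatible G u) T →
        All (λ t → E t i e ≡ true → E t i f ≡ true) T
      transfer-all u []      f∈u e∉u []       = []
      transfer-all u (t ∷ T) f∈u e∉u (c ∷ cs) =
        compatible-transfer t u f∈u e∉u (inj₂ c) ∷ transfer-all u T f∈u e∉u cs

      -- for v ∈ T containing f but not e, v itself is counted for e and not for f
      strictly-fewer-miss-f : ∀ v → E v i f ≡ true → E v i e ≡ false →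
        ∀ T → AllPairs (Compatible G) T → _∈_ G v T → notContaining G T i f < notContaining G T i e
      strictly-fewer-miss-f v f∈v e∉v (t ∷ T) (cs ∷ _) (here v≈t) =
        head-counts (E t i e) (E t i f) e∉t f∈t (missing-f≤missing-e T (transfer-all t T f∈t e∉t cs))
        where
        f∈t = trans (sym (proj₂ v≈t i f)) f∈v
        e∉t = trans (sym (proj₂ v≈t i e)) e∉v
        head-counts : ∀ x y {A B} → x ≡ false → y ≡ true → A ≤ B → suc ([ not y ] + A) ≤ [ not x ] + B
        head-counts false true refl refl A≤B = s≤s A≤B
      strictly-fewer-miss-f v f∈v e∉v (t ∷ T) (cs ∷ pairs) (there v∈T)
        with compatible-member v t T v∈T cs
      ... | u , v≈u , t~u =
        +-mono-≤-< (¬-anti (E t i e) (E t i f)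
                      (compatible-transfer t u (trans (sym (proj₂ v≈u i f)) f∈v)
                                               (trans (sym (proj₂ v≈u i e)) e∉v) (inj₁ t~u)))
                   (strictly-fewer-miss-f v f∈v e∉v T pairs v∈T)

    -- an edge of v preceded (in the ordering) by an edge missing from v would be
    -- missed by strictly fewer tubes than that earlier edge
    tube-edges-initial : ∀ v (T : List (Subgraph G)) → AllPairs (Compatible G) T → _∈_ G v T →
      (ord : (i : Fin p) → Fin (mult i) → Fin (mult i)) → IsBundleOrdering G T ord →
      ∀ i → IsInitialSegment (mult i) (λ x → E v i (ord i x))
    tube-edges-initial v T pairs v∈T ord (_ , ord-mono) i x y x≤y y∈v with E v i (ord i x) in x∈v
    ... | true  = refl
    ... | false with m≤n⇒m<n∨m≡n x≤y
    ...   | inj₂ x≡y rewrite toℕ-injective {i = x} {j = y} x≡y with trans (sym x∈v) y∈v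
    ...     | ()
    tube-edges-initial v T pairs v∈T ord (_ , ord-mono) i x y x≤y y∈v | false | inj₁ x<y =
      ⊥-elim (<⇒≱ (strictly-fewer-miss-f i (ord i x) (ord i y) v y∈v x∈v T pairs v∈T) (ord-mono i x y x<y))

    -- Counting nodes and edges together: |φ| + |ψ| for a node predicate φ and an
    -- edge predicate ψ.  In particular  outside t = elements (not ∘ V t) (not ∘ E t).
    elements : (Fin n → Bool) → ((i : Fin p) → Fin (mult i) → Bool) → ℕ
    elements φ ψ = count n φ + sumℕ p (λ i → count (mult i) (ψ i))

    elements-additive : ∀ φ ψ φ₁ ψ₁ φ₂ ψ₂ → (∀ w → [ φ w ] ≡ [ φ₁ w ] + [ φ₂ w ]) →
      (∀ i k → [ ψ i k ] ≡ [ ψ₁ i k ] + [ ψ₂ i k ]) → elements φ ψ ≡ elements φ₁ ψ₁ + elements φ₂ ψ₂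
    elements-additive φ ψ φ₁ ψ₁ φ₂ ψ₂ split-φ split-ψ = begin
      count n φ + sumℕ p (λ i → count (mult i) (ψ i))
        ≡⟨ cong₂ _+_ (count-additive n φ φ₁ φ₂ split-φ)
                     (trans (sum-cong p (λ i → count-additive (mult i) (ψ i) (ψ₁ i) (ψ₂ i) (split-ψ i)))
                            (sum-+ p _ _)) ⟩
      (count n φ₁ + count n φ₂) + (sumℕ p (λ i → count (mult i) (ψ₁ i)) + sumℕ p (λ i → count (mult i) (ψ₂ i)))
        ≡⟨ interchange (count n φ₁) (count n φ₂) _ _ ⟩
      elements φ₁ ψ₁ + elements φ₂ ψ₂ ∎
      where
      open ≡-Reasoning
      interchange : ∀ a b c d → (a + b) + (c + d) ≡ (a + c) + (b + d)
      interchange = solve-∀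

    elements≡0⇒ : ∀ φ ψ → elements φ ψ ≡ 0 → (∀ w → φ w ≡ false) × (∀ i k → ψ i k ≡ false)
    elements≡0⇒ φ ψ h =
      count≡0⇒ n φ (m+n≡0⇒m≡0 _ h) ,
      (λ i → count≡0⇒ (mult i) (ψ i) (sum≡0⇒ p _ (m+n≡0⇒n≡0 (count n φ) h) i))

    difference : Subgraph G → Subgraph G → ℕ
    difference s t = elements (λ w → V s w ∧ not (V t w)) (λ i k → E s i k ∧ not (E t i k))

    difference-pos : ∀ s t → ¬ (s ⊆ᴳ t) → 1 ≤ difference s t
    difference-pos s t s⊈t with difference s t in d
    ... | suc _ = s≤s z≤n
    ... | zero  = ⊥-elim (s⊈t ((λ w h → ∧-not≡false⇒ _ _ h (proj₁ none w)) ,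
                               (λ i k h → ∧-not≡false⇒ _ _ h (proj₂ none i k))))
      where none = elements≡0⇒ _ _ d

    outside-∪ : ∀ a b → outside G a ≡ outside G (a ∪ᴳ b) + difference b a
    outside-∪ a b = elements-additive _ _ _ _ _ _ (λ w → split (V a w) (V b w)) (λ i k → split (E a i k) (E b i k))
      where
      split : ∀ x y → [ not x ] ≡ [ not (x ∨ y) ] + [ y ∧ not x ]
      split false false = refl
      split false true  = refl
      split true  false = refl
      split true  true  = refl

    outside-∩ : ∀ a b → outside G (a ∩ᴳ b) ≡ outside G a + difference a b
    outside-∩ a b = elements-additive _ _ _ _ _ _ (λ w → split (V a w) (V b w)) (λ i k → split (E a i k) (E b i k))
      where
      split : ∀ x y → [ not (x ∧ y) ] ≡ [ not x ] + [ x ∧ not y ]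
      split false _     = refl
      split true  false = refl
      split true  true  = refl

    ∪-comm : ∀ a b → (a ∪ᴳ b) ≈ᴳ (b ∪ᴳ a)
    ∪-comm a b = (λ w → ∨-comm (V a w) (V b w)) , (λ i k → ∨-comm (E a i k) (E b i k))

    Λ-exchange : ∀ a b → Nested (V a) (V b) → BundleCompatible G a b →
      Λ G (a ∪ᴳ b) + Λ G (a ∩ᴳ b) ≡ (Λ G a + Λ G b) + 2 * difference a b * difference b a
    Λ-exchange a b nodes-nested bundles-nested = begin
      Λ G (a ∪ᴳ b) + Λ G (a ∩ᴳ b)
        ≡⟨ regroup (c ^ nodesOf G U) (edgeTerms U) (oU * oU) (c ^ nodesOf G I) (edgeTerms I) (oI * oI) ⟩
      (c ^ nodesOf G U + c ^ nodesOf G I) + (edgeTerms U + edgeTerms I) + (oU * oU + oI * oI)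
        ≡⟨ cong₂ _+_ (cong₂ _+_ (exchange n c (V a) (V b) nodes-nested) edges-exchange) squares ⟩
      (c ^ nodesOf G a + c ^ nodesOf G b) + (edgeTerms a + edgeTerms b)
        + ((oU + xb) * (oU + xb) + (oU + xa) * (oU + xa) + 2 * xa * xb)
        ≡⟨ sym (regroup′ (c ^ nodesOf G a) (edgeTerms a) ((oU + xb) * (oU + xb))
                         (c ^ nodesOf G b) (edgeTerms b) ((oU + xa) * (oU + xa)) (2 * xa * xb)) ⟩
      (c ^ nodesOf G a + edgeTerms a + (oU + xb) * (oU + xb))
        + (c ^ nodesOf G b + edgeTerms b + (oU + xa) * (oU + xa)) + 2 * xa * xb
        ≡⟨ cong₂ (λ s t → (c ^ nodesOf G a + edgeTerms a + s * s) + (c ^ nodesOf G b + edgeTerms b + t * t)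
                          + 2 * xa * xb) (sym (outside-∪ a b)) (sym oB) ⟩
      (Λ G a + Λ G b) + 2 * xa * xb ∎
      where
      open ≡-Reasoning
      c = cst G
      U = a ∪ᴳ b
      I = a ∩ᴳ b
      xa = difference a b
      xb = difference b a
      oU = outside G U
      oI = outside G I
      edgeTerms : Subgraph G → ℕ
      edgeTerms t = sumℕ p (λ i → c ^ edgesOf G t i)
      oB : outside G b ≡ oU + xa
      oB = trans (outside-∪ b a) (cong (_+ xa) (outside-≈ {b ∪ᴳ a} {U} (∪-comm b a)))
      edges-exchange : edgeTerms U + edgeTerms I ≡ edgeTerms a + edgeTerms b
      edges-exchange = trans (sym (sum-+ p _ _))
        (trans (sum-cong p (λ i → exchange (mult i) c (E a i) (E b i) (bundles-nested i))) (sum-+ p _ _))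
      square-identity : ∀ o x y → o * o + ((o + y) + x) * ((o + y) + x) ≡ (o + y) * (o + y) + (o + x) * (o + x) + 2 * x * y
      square-identity = solve-∀
      squares : oU * oU + oI * oI ≡ (oU + xb) * (oU + xb) + (oU + xa) * (oU + xa) + 2 * xa * xb
      squares = trans (cong (λ z → oU * oU + z * z) (trans (outside-∩ a b) (cong (_+ xa) (outside-∪ a b))))
                      (square-identity oU xa xb)
      regroup : ∀ n₁ s₁ q₁ n₂ s₂ q₂ → (n₁ + s₁ + q₁) + (n₂ + s₂ + q₂) ≡ (n₁ + n₂) + (s₁ + s₂) + (q₁ + q₂)
      regroup = solve-∀
      regroup′ : ∀ n₁ s₁ q₁ n₂ s₂ q₂ z → (n₁ + s₁ + q₁) + (n₂ + s₂ + q₂) + z ≡ (n₁ + n₂) + (s₁ + s₂) + (q₁ + q₂ + z)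
      regroup′ = solve-∀

    tube-between : ∀ U t v → IsTube G t → IsTube G v → (∀ w → V U w ≡ true → V t w ≡ true) →
      t ⊆ᴳ U → U ⊆ᴳ v → IsTube G U
    tube-between U t v ((nonempty , paths) , _ , t-full-on-nodes) (_ , v-proper , _) U⊆t t⊆U U⊆v =
        ((proj₁ nonempty , proj₁ t⊆U _ (proj₂ nonempty)) ,
         (λ x y x∈ y∈ → Reach-transfer (λ i k e → k , proj₂ t⊆U i k e) (paths x y (U⊆t x x∈) (U⊆t y y∈))))
      , (λ { (all-V , all-E) → v-proper ((λ w → proj₁ U⊆v w (all-V w)) , (λ i k → proj₂ U⊆v i k (all-E i k))) })
      , (λ i x y x∈ y∈ joins → let (k , e) = t-full-on-nodes i x y (U⊆t x x∈) (U⊆t y y∈) joins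
                               in k , proj₂ t⊆U i k e)

    -- If the nodes of the connected s lie in the tube t and the tubes are bundle
    -- compatible, then s ∩ t is connected: an edge of s used by a path has both
    -- ends in t, so t has an edge of that bundle, and one of the two lies in s ∩ t.
    meet-connected : ∀ s t → Connected G s → IsTube G t → (∀ w → V s w ≡ true → V t w ≡ true) →
      BundleCompatible G s t → Connected G (s ∩ᴳ t)
    meet-connected s t ((x₀ , x₀∈s) , paths) (_ , _ , t-full-on-nodes) Vs⊆Vt bundles-nested =
      (x₀ , ∧-intro x₀∈s (Vs⊆Vt x₀ x₀∈s)) ,
      (λ x y x∈ y∈ → Reach-transfer edge-in-meet
                       (paths x y (proj₁ (∧-elim (V s x) _ x∈)) (proj₁ (∧-elim (V s y) _ y∈))))
      where
      edge-in-meet : ∀ i k → E s i k ≡ true → ∃ λ k' → E (s ∩ᴳ t) i k' ≡ true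
      edge-in-meet i k e
        with t-full-on-nodes i (src i) (tgt i) (Vs⊆Vt _ (proj₁ (closed s i k e))) (Vs⊆Vt _ (proj₂ (closed s i k e)))
                             (inj₁ (refl , refl))
      ... | k' , e' with bundles-nested i
      ...   | inj₁ Es⊆Et = k  , ∧-intro e (Es⊆Et k e)
      ...   | inj₂ Et⊆Es = k' , ∧-intro (Et⊆Es k' e') e'

    ∩-comm : ∀ a b → (a ∩ᴳ b) ≈ᴳ (b ∩ᴳ a)
    ∩-comm a b = (λ w → ∧-comm (V a w) (V b w)) , (λ i k → ∧-comm (E a i k) (E b i k))

    Connected-≈ : ∀ s t → s ≈ᴳ t → Connected G s → Connected G t
    Connected-≈ s t (same-V , same-E) ((x₀ , x₀∈) , paths) =
      (x₀ , trans (sym (same-V x₀)) x₀∈) ,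
      (λ x y x∈ y∈ → Reach-transfer (λ i k e → k , trans (sym (same-E i k)) e)
                       (paths x y (trans (same-V x) x∈) (trans (same-V y) y∈)))

    -- A component K of a connected H is all of H: everything reachable from a
    -- node of K stays in K.
    Reach-stays-in-component : ∀ {H K} → IsComponentOf G K H → ∀ {x y} → Reach G H x y →
      V K x ≡ true → V K y ≡ true
    Reach-stays-in-component c here x∈K = x∈K
    Reach-stays-in-component {H} {K} c@(_ , _ , full) (step i k e (inj₁ (refl , refl)) r) x∈K =
      Reach-stays-in-component c r (proj₂ (closed K i k (full i k e (inj₁ x∈K))))
    Reach-stays-in-component {H} {K} c@(_ , _ , full) (step i k e (inj₂ (refl , refl)) r) x∈K =
      Reach-stays-in-component c r (proj₁ (closed K i k (full i k e (inj₂ x∈K))))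

    component-of-connected : ∀ H K → Connected G H → IsComponentOf G K H → K ≈ᴳ H
    component-of-connected H K (_ , paths) c@(K⊆H , ((x₀ , x₀∈K) , _) , full) =
      (λ w → bool-ext _ _ (proj₁ K⊆H w) (λ w∈H → stays w w∈H)) ,
      (λ i k → bool-ext _ _ (proj₂ K⊆H i k) (λ e → full i k e (inj₁ (stays (src i) (proj₁ (closed H i k e))))))
      where
      stays : ∀ w → V H w ≡ true → V K w ≡ true
      stays w w∈H = Reach-stays-in-component c (paths x₀ w (proj₁ K⊆H x₀ x₀∈K) w∈H) x₀∈K

    -- If H is connected, a duplicate-free list of its components is [H]: every
    -- member equals H, and H itself is a component.
    components-of-connected : ∀ H (W : List (Subgraph G)) → Connected G H →
      AllPairs (λ x y → ¬ (x ≈ᴳ y)) W → (∀ K → _∈_ G K W ⇔ IsComponentOf G K H) →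
      sumΛ G W ≡ ℤ.+ Λ G H ℤ.+ ℤ.+ 0
    components-of-connected H W H-conn W-distinct W-spec = by-length W W-distinct member≈H H∈W
      where
      member≈H : ∀ w → _∈_ G w W → w ≈ᴳ H
      member≈H w w∈W = component-of-connected H w H-conn (Equivalence.to (W-spec w) w∈W)
      H∈W : _∈_ G H W
      H∈W = Equivalence.from (W-spec H) (((λ _ h → h) , (λ _ _ h → h)) , H-conn , (λ _ _ e _ → e))
      by-length : ∀ W → AllPairs (λ x y → ¬ (x ≈ᴳ y)) W → (∀ w → _∈_ G w W → w ≈ᴳ H) → _∈_ G H W →
        sumΛ G W ≡ ℤ.+ Λ G H ℤ.+ ℤ.+ 0
      by-length []           _ _     ()
      by-length (w ∷ []) _ all≈H _ = cong (λ z → ℤ.+ z ℤ.+ ℤ.+ 0) (Λ-≈ {w} {H} (all≈H w (here (≈-refl {w}))))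
      by-length (w₀ ∷ w₁ ∷ W) ((w₀≉w₁ ∷ _) ∷ _) all≈H _ =
        ⊥-elim (w₀≉w₁ (≈-trans {w₀} {H} {w₁} (all≈H w₀ (here (≈-refl {w₀})))
                                            (≈-sym {w₁} {H} (all≈H w₁ (there (here (≈-refl {w₁})))))))

    -- Nested node sets rule out adjacency (a and b share the nodes of the smaller).
    nested⇒properly-intersecting : ∀ a b → IsTube G a → IsTube G b → Nested (V a) (V b) →
      Adjacent G a b ⊎ ProperlyIntersecting G a b → ProperlyIntersecting G a b
    nested⇒properly-intersecting a b _ _ _ (inj₂ pi) = pi
    nested⇒properly-intersecting a b (((x , x∈a) , _) , _) _ (inj₁ Va⊆Vb) (inj₁ (disjoint , _)) =
      ⊥-elim (disjoint x (x∈a , Va⊆Vb x x∈a))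
    nested⇒properly-intersecting a b _ (((x , x∈b) , _) , _) (inj₂ Vb⊆Va) (inj₁ (disjoint , _)) =
      ⊥-elim (disjoint x (Vb⊆Va x x∈b , x∈b))

    -- With nested node sets, a ∪ b is a tube inside v, hence equal to v.
    union-is-minimal-tube : ∀ a b v → IsTube G a → IsTube G b → Nested (V a) (V b) →
      IsMinimalTubeContaining G a b v → (a ∪ᴳ b) ≈ᴳ v
    union-is-minimal-tube a b v a-tube b-tube nodes-nested (v-tube , a⊆v , b⊆v , minimal) =
      minimal U U-tube a⊆U b⊆U U⊆v
      where
      U = a ∪ᴳ b
      a⊆U : a ⊆ᴳ U
      a⊆U = (λ w h → ∨-introˡ _ _ h) , (λ i k h → ∨-introˡ _ _ h)
      b⊆U : b ⊆ᴳ U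
      b⊆U = (λ w h → ∨-introʳ (V a w) _ h) , (λ i k h → ∨-introʳ (E a i k) _ h)
      U⊆v : U ⊆ᴳ v
      U⊆v = (λ w h → [ proj₁ a⊆v w , proj₁ b⊆v w ]′ (∨-elim (V a w) _ h)) ,
            (λ i k h → [ proj₂ a⊆v i k , proj₂ b⊆v i k ]′ (∨-elim (E a i k) _ h))
      U-tube : IsTube G U
      U-tube = [ (λ Va⊆Vb → tube-between U b v b-tube v-tube
                               (λ w h → [ Va⊆Vb w , (λ x → x) ]′ (∨-elim (V a w) _ h)) b⊆U U⊆v)
               , (λ Vb⊆Va → tube-between U a v a-tube v-tube
                               (λ w h → [ (λ x → x) , Vb⊆Va w ]′ (∨-elim (V a w) _ h)) a⊆U U⊆v) ]′ nodes-nested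

    -- If v = a ∪ b then no edge of v lies outside a and b, so Σ_{E∨} f_T vanishes.
    sumF-of-union : ∀ a b v ord Lg → (a ∪ᴳ b) ≈ᴳ v → sumF G ord Lg a b v ≡ ℤ.+ 0
    sumF-of-union a b v ord Lg (_ , same-E) =
      sumℤ-zeros p _ (λ i → sumℤ-zeros (mult i) _ (λ x → no-new-edge i (ord i x) (toℕ x)))
      where
      not-new : ∀ x y z → (x ∨ y) ≡ z → (z ∧ (not x ∧ not y)) ≡ false
      not-new false false _ refl = refl
      not-new false true  _ refl = refl
      not-new true  _     _ refl = refl
      no-new-edge : ∀ i k j → (if inEvee G a b v i k then fpos G Lg i j else ℤ.+ 0) ≡ ℤ.+ 0
      no-new-edge i k j rewrite not-new (E a i k) (E b i k) (E v i k) (same-E i k) = refl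

    a∩b-connected : ∀ a b → IsTube G a → IsTube G b → Nested (V a) (V b) → BundleCompatible G a b →
      Connected G (a ∩ᴳ b)
    a∩b-connected a b (a-conn , _) b-tube (inj₁ Va⊆Vb) bc = meet-connected a b a-conn b-tube Va⊆Vb bc
    a∩b-connected a b a-tube (b-conn , _) (inj₂ Vb⊆Va) bc =
      Connected-≈ (b ∩ᴳ a) (a ∩ᴳ b) (∩-comm b a)
        (meet-connected b a b-conn a-tube Vb⊆Va (λ i → [ inj₂ , inj₁ ]′ (bc i)))

    nested-case : ∀ a b → IsTube G a → IsTube G b → BundleCompatible G a b → Nested (V a) (V b) →
      Adjacent G a b ⊎ ProperlyIntersecting G a b →
      (W : List (Subgraph G)) → AllPairs (λ x y → ¬ (x ≈ᴳ y)) W →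
      (∀ K → _∈_ G K W ⇔ IsComponentOf G K (a ∩ᴳ b)) →
      (v : Subgraph G) → IsMinimalTubeContaining G a b v →
      (ord : (i : Fin p) → Fin (mult i) → Fin (mult i)) (Lg : (i : Fin p) → ℕ → Subgraph G) →
      ℤ.+ Λ G a ℤ.< ((ℤ.+ Λ G v ℤ.- ℤ.+ Λ G b) ℤ.+ sumΛ G W) ℤ.- sumF G ord Lg a b v
    nested-case a b a-tube b-tube bc nodes-nested adj-or-pi W W-distinct W-spec v v-minimal ord Lg =
      subst (λ z → ℤ.+ Λ G a ℤ.< ((ℤ.+ Λ G v ℤ.- ℤ.+ Λ G b) ℤ.+ z) ℤ.- sumF G ord Lg a b v)
            (sym (trans W-is-meet (ℤP.+-identityʳ (ℤ.+ Λ G (a ∩ᴳ b)))))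
            (integer-form (Λ G a) (Λ G b) (Λ G v) (Λ G (a ∩ᴳ b)) 0 _
                          (ℤP.≤-reflexive (sumF-of-union a b v ord Lg U≈v)) Λ-gain)
      where
      open ≤-Reasoning
      U≈v = union-is-minimal-tube a b v a-tube b-tube nodes-nested v-minimal
      W-is-meet = components-of-connected (a ∩ᴳ b) W (a∩b-connected a b a-tube b-tube nodes-nested bc)
                                          W-distinct W-spec
      pi = nested⇒properly-intersecting a b a-tube b-tube nodes-nested adj-or-pi
      positive-product : ∀ x y → 1 ≤ x → 1 ≤ y → 1 ≤ 2 * x * y
      positive-product (suc x) (suc y) _ _ = s≤s z≤n
      Λ-gain : Λ G a + Λ G b + 0 < Λ G v + Λ G (a ∩ᴳ b)
      Λ-gain = begin-strict
        Λ G a + Λ G b + 0                   ≡⟨ +-identityʳ _ ⟩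
        Λ G a + Λ G b                       <⟨ m<m+n _ (positive-product _ _ (difference-pos a b (proj₁ (proj₂ pi)))
                                                                              (difference-pos b a (proj₂ (proj₂ pi)))) ⟩
        (Λ G a + Λ G b) + 2 * difference a b * difference b a
                                            ≡⟨ sym (Λ-exchange a b nodes-nested bc) ⟩
        Λ G (a ∪ᴳ b) + Λ G (a ∩ᴳ b)         ≡⟨ cong (_+ Λ G (a ∩ᴳ b)) (Λ-≈ {a ∪ᴳ b} {v} U≈v) ⟩
        Λ G v + Λ G (a ∩ᴳ b)                ∎

    sumOver : List (Subgraph G) → (Subgraph G → ℕ) → ℕ
    sumOver []      f = 0
    sumOver (w ∷ W) f = f w + sumOver W f

    sumΛ≡sumOver : ∀ W → sumΛ G W ≡ ℤ.+ sumOver W (Λ G)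
    sumΛ≡sumOver []      = refl
    sumΛ≡sumOver (w ∷ W) = trans (cong (ℤ._+_ (ℤ.+ Λ G w)) (sumΛ≡sumOver W)) (sym (ℤP.pos-+ (Λ G w) _))

    member≤sumOver : ∀ K W (f : Subgraph G → ℕ) → (∀ x y → x ≈ᴳ y → f x ≡ f y) → _∈_ G K W →
      f K ≤ sumOver W f
    member≤sumOver K (w ∷ W) f f-≈ (here K≈w) = ≤-trans (≤-reflexive (f-≈ K w K≈w)) (m≤m+n _ _)
    member≤sumOver K (w ∷ W) f f-≈ (there K∈) = ≤-trans (member≤sumOver K W f f-≈ K∈) (m≤n+m _ _)

    sumOver-mono : ∀ W (f g : Subgraph G → ℕ) → (∀ w → f w ≤ g w) → sumOver W f ≤ sumOver W g
    sumOver-mono []      f g h = z≤n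
    sumOver-mono (w ∷ W) f g h = +-mono-≤ (h w) (sumOver-mono W f g h)

    sum-sumOver-swap : ∀ W (g : Fin p → Subgraph G → ℕ) →
      sumℕ p (λ i → sumOver W (g i)) ≡ sumOver W (λ w → sumℕ p (λ i → g i w))
    sum-sumOver-swap []      g = trans (sum-const p 0) (*-zeroʳ p)
    sum-sumOver-swap (w ∷ W) g = trans (sum-+ p (λ i → g i w) (λ i → sumOver W (g i)))
                                       (cong (sumℕ p (λ i → g i w) +_) (sum-sumOver-swap W g))

    -- The edges of a bundle in a ∩ b all lie in one component of a ∩ b (the one
    -- through their common ends), so  c^|E(i, a ∩ b)| ≤ 1 + Σ_W c^|E(i, w)|.
    meet-bundle-bound : ∀ c a b W → (∀ K → _∈_ G K W ⇔ IsComponentOf G K (a ∩ᴳ b)) → ∀ i →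
      c ^ edgesOf G (a ∩ᴳ b) i ≤ 1 + sumOver W (λ w → c ^ edgesOf G w i)
    meet-bundle-bound c a b W W-spec i with none-or-witness (mult i) (E (a ∩ᴳ b) i)
    ... | inj₁ none = ≤-trans (≤-reflexive (cong (c ^_) (sum-none (mult i) _ (λ _ → 1) none))) (m≤m+n 1 _)
    ... | inj₂ (k , k∈H) = begin
        c ^ edgesOf G H i    ≡⟨ cong (c ^_) (count-cong (mult i) _ _ same-edges) ⟩
        c ^ edgesOf G K i    ≤⟨ member≤sumOver K W (λ w → c ^ edgesOf G w i)
                                  (λ x y x≈y → cong (c ^_) (edgesOf-≈ {x} {y} x≈y i))
                                  (Equivalence.from (W-spec K) isComponent) ⟩
        sumOver W _          ≤⟨ m≤n+m _ 1 ⟩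
        1 + sumOver W _      ∎
      where
      open ≤-Reasoning
      H = a ∩ᴳ b
      open ComponentOf H (src i) (proj₁ (closed H i k k∈H)) using (component; u∈component; isComponent)
      K = component
      same-edges : ∀ k → E H i k ≡ E K i k
      same-edges k = sym (trans (cong (E H i k ∧_) u∈component) (∧-identityʳ (E H i k)))

    -- Bounds on f_T.  With  σ_i = Σ_x 2|G − G_{e(i,x)}|  (the separating tubes of
    -- bundle i),  f_T(e(i,1)) ≤ c + σ_i  and  f_T(e(i,j+1)) ≤ c^j (c − 1) + 1.
    separatorTotal : ((i : Fin p) → ℕ → Subgraph G) → Fin p → ℕ
    separatorTotal Lg i = sumℕ (mult i ∸ 1) (λ x → 2 * outside G (Lg i (toℕ x)))

    atFirst : ℕ → ℕ → ℕ
    atFirst g zero    = g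
    atFirst g (suc _) = 0

    fpos-bound : 1 ≤ cst G → ∀ Lg i j →
      fpos G Lg i j ℤ.≤ ℤ.+ (weight (cst G) j + 1 + atFirst (separatorTotal Lg i) j)
    fpos-bound 1≤c Lg i zero = begin
      ℤ.+ c ℤ.+ sumℤ (mult i ∸ 1) (λ x → gap G (Lg i (toℕ x)))
        ≤⟨ ℤP.+-monoʳ-≤ (ℤ.+ c) (sumℤ-≤ (mult i ∸ 1) _ _ (λ x → ℤP.m⊖n≤m (2 * outside G (Lg i (toℕ x))) 1)) ⟩
      ℤ.+ c ℤ.+ ℤ.+ separatorTotal Lg i
        ≡⟨ sym (ℤP.pos-+ c _) ⟩
      ℤ.+ (c + separatorTotal Lg i)
        ≡⟨ cong (λ z → ℤ.+ (z + separatorTotal Lg i)) c≡weight+1 ⟩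
      ℤ.+ (weight c 0 + 1 + separatorTotal Lg i) ∎
      where
      open ℤP.≤-Reasoning
      c = cst G
      c≡weight+1 : c ≡ weight c 0 + 1
      c≡weight+1 = trans (sym (m∸n+n≡m 1≤c)) (cong (_+ 1) (sym (*-identityˡ (c ∸ 1))))
    fpos-bound 1≤c Lg i (suc j) = begin
      ℤ.+ (c ^ suc j) ℤ.* (ℤ.+ c ℤ.- ℤ.+ 1) ℤ.- gap G (Lg i j)
        ≤⟨ ℤP.+-monoʳ-≤ (ℤ.+ (c ^ suc j) ℤ.* (ℤ.+ c ℤ.- ℤ.+ 1)) -gap≤1 ⟩
      ℤ.+ (c ^ suc j) ℤ.* (ℤ.+ c ℤ.- ℤ.+ 1) ℤ.+ ℤ.+ 1
        ≡⟨ cong (λ z → ℤ.+ (c ^ suc j) ℤ.* z ℤ.+ ℤ.+ 1) (ℤP.⊖-≥ 1≤c) ⟩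
      ℤ.+ (c ^ suc j) ℤ.* ℤ.+ (c ∸ 1) ℤ.+ ℤ.+ 1
        ≡⟨ cong (ℤ._+ ℤ.+ 1) (sym (ℤP.pos-* (c ^ suc j) (c ∸ 1))) ⟩
      ℤ.+ weight c (suc j) ℤ.+ ℤ.+ 1
        ≡⟨ sym (ℤP.pos-+ (weight c (suc j)) 1) ⟩
      ℤ.+ (weight c (suc j) + 1)
        ≡⟨ cong ℤ.+_ (sym (+-identityʳ _)) ⟩
      ℤ.+ (weight c (suc j) + 1 + 0) ∎
      where
      open ℤP.≤-Reasoning
      c = cst G
      -gap≤1 : ℤ.- gap G (Lg i j) ℤ.≤ ℤ.+ 1
      -gap≤1 = subst (ℤ._≤ ℤ.+ 1) (ℤP.⊖-swap 1 (2 * outside G (Lg i j))) (ℤP.m⊖n≤m 1 (2 * outside G (Lg i j)))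

    newEdgeAt : (a b v : Subgraph G) → ((i : Fin p) → Fin (mult i) → Fin (mult i)) →
      (i : Fin p) → Fin (mult i) → Bool
    newEdgeAt a b v ord i x = inEvee G a b v i (ord i x)

    -- Summing the bounds on f_T over E∨ ∩ B_i: the weights of its positions, plus
    -- 1 per edge, plus σ_i (charged to the first position only).
    f-bundle-bound : 1 ≤ cst G → ∀ a b v ord Lg i →
      sumℤ (mult i) (λ x → if newEdgeAt a b v ord i x then fpos G Lg i (toℕ x) else ℤ.+ 0)
        ℤ.≤ ℤ.+ (weightOf (cst G) (mult i) (newEdgeAt a b v ord i) + mult i + separatorTotal Lg i)
    f-bundle-bound 1≤c a b v ord Lg i =
      ℤP.≤-trans (sumℤ-≤ m _ termBound termwise) (+≤+ (≤-trans (≤-reflexive sum-termBound) first-only))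
      where
      m = mult i
      S = newEdgeAt a b v ord i
      σ = separatorTotal Lg i
      termBound : Fin m → ℕ
      termBound x = ((if S x then weight (cst G) (toℕ x) else 0) + 1) + atFirst σ (toℕ x)
      termwise : ∀ x → (if S x then fpos G Lg i (toℕ x) else ℤ.+ 0) ℤ.≤ ℤ.+ termBound x
      termwise x with S x
      ... | true  = fpos-bound 1≤c Lg i (toℕ x)
      ... | false = +≤+ z≤n
      sum-termBound : sumℕ m termBound ≡ weightOf (cst G) m S + m + sumℕ m (λ x → atFirst σ (toℕ x))
      sum-termBound = trans (sum-+ m _ _) (cong (_+ sumℕ m (λ x → atFirst σ (toℕ x))) (trans (sum-+ m _ _)
                        (cong (weightOf (cst G) m S +_) (trans (sum-const m 1) (*-identityʳ m)))))
      atFirst-sum : ∀ k → sumℕ k (λ x → atFirst σ (toℕ x)) ≤ σ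
      atFirst-sum zero    = z≤n
      atFirst-sum (suc k) = ≤-reflexive (trans (cong (σ +_) (trans (sum-const k 0) (*-zeroʳ k))) (+-identityʳ σ))
      first-only : weightOf (cst G) m S + m + sumℕ m (λ x → atFirst σ (toℕ x)) ≤ weightOf (cst G) m S + m + σ
      first-only = +-monoʳ-≤ (weightOf (cst G) m S + m) (atFirst-sum m)

    -- The edge terms of bundle i: by the exchange identity, c^|E(i,a)| + c^|E(i,b)|
    -- = c^|E(i,a ∪ b)| + c^|E(i,a ∩ b)|, and the edges of a ∪ b together with E∨
    -- are disjoint parts of the initial segment formed by the edges of v.
    edge-bundle-bound : ∀ c .{{_ : ℕ.NonZero c}} a b v ord i → a ⊆ᴳ v → b ⊆ᴳ v →
      Bijective _≡_ _≡_ (ord i) → IsInitialSegment (mult i) (λ x → E v i (ord i x)) →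
      Nested (E a i) (E b i) →
      c ^ edgesOf G a i + c ^ edgesOf G b i + weightOf c (mult i) (newEdgeAt a b v ord i)
        ≤ c ^ edgesOf G v i + c ^ edgesOf G (a ∩ᴳ b) i
    edge-bundle-bound c a b v ord i a⊆v b⊆v ord-bijective v-initial edges-nested = begin
      c ^ edgesOf G a i + c ^ edgesOf G b i + new
        ≡⟨ cong (_+ new) (sym (exchange m c (E a i) (E b i) edges-nested)) ⟩
      c ^ count m ab + c ^ edgesOf G (a ∩ᴳ b) i + new
        ≡⟨ +-assoc (c ^ count m ab) _ new ⟩
      c ^ count m ab + (c ^ edgesOf G (a ∩ᴳ b) i + new)
        ≡⟨ cong (c ^ count m ab +_) (+-comm _ new) ⟩
      c ^ count m ab + (new + c ^ edgesOf G (a ∩ᴳ b) i)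
        ≡⟨ sym (+-assoc (c ^ count m ab) new _) ⟩
      c ^ count m ab + new + c ^ edgesOf G (a ∩ᴳ b) i
        ≡⟨ cong (λ z → c ^ z + new + c ^ edgesOf G (a ∩ᴳ b) i) (sym (count-permute m (ord i) ord-bijective ab)) ⟩
      c ^ count m (λ x → ab (ord i x)) + new + c ^ edgesOf G (a ∩ᴳ b) i
        ≤⟨ +-monoˡ-≤ _ (initial-segment-bound c m (λ x → E v i (ord i x)) (λ x → ab (ord i x))
                          (newEdgeAt a b v ord i) v-initial
                          (λ x h → [ proj₂ a⊆v i (ord i x) , proj₂ b⊆v i (ord i x) ]′ (∨-elim (E a i (ord i x)) _ h))
                          (λ x h → proj₁ (∧-elim (E v i (ord i x)) _ h))
                          (λ x h → new-not-old (E v i (ord i x)) (E a i (ord i x)) (E b i (ord i x)) h)) ⟩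
      c ^ count m (λ x → E v i (ord i x)) + c ^ edgesOf G (a ∩ᴳ b) i
        ≡⟨ cong (λ z → c ^ z + c ^ edgesOf G (a ∩ᴳ b) i) (count-permute m (ord i) ord-bijective (E v i)) ⟩
      c ^ edgesOf G v i + c ^ edgesOf G (a ∩ᴳ b) i ∎
      where
      open ≤-Reasoning
      m = mult i
      ab : Fin m → Bool
      ab k = E a i k ∨ E b i k
      new = weightOf c m (newEdgeAt a b v ord i)
      new-not-old : ∀ x y z → (x ∧ (not y ∧ not z)) ≡ true → (y ∨ z) ≡ false
      new-not-old true false false _ = refl

    edgeTerms : Subgraph G → ℕ
    edgeTerms t = sumℕ p (λ i → cst G ^ edgesOf G t i)

    totalEdges : ℕ
    totalEdges = sumℕ p mult

    outside≤size : ∀ t → outside G t ≤ size G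
    outside≤size t = +-mono-≤ (count≤ n _) (sum-mono p (λ i → count≤ (mult i) _))

    separatorTotal-sum : ∀ Lg → sumℕ p (separatorTotal Lg) ≤ 2 * size G * totalEdges
    separatorTotal-sum Lg = begin
      sumℕ p (separatorTotal Lg)
        ≤⟨ sum-mono p per-bundle ⟩
      sumℕ p (λ i → 2 * size G * mult i)
        ≡⟨ sum-*ˡ p (2 * size G) mult ⟩
      2 * size G * totalEdges ∎
      where
      open ≤-Reasoning
      per-bundle : ∀ i → separatorTotal Lg i ≤ 2 * size G * mult i
      per-bundle i = begin
        separatorTotal Lg i
          ≤⟨ sum-mono (mult i ∸ 1) (λ x → *-monoʳ-≤ 2 (outside≤size (Lg i (toℕ x)))) ⟩
        sumℕ (mult i ∸ 1) (λ _ → 2 * size G)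
          ≡⟨ trans (sum-const (mult i ∸ 1) _) (*-comm (mult i ∸ 1) _) ⟩
        2 * size G * (mult i ∸ 1)
          ≤⟨ *-monoʳ-≤ (2 * size G) (m∸n≤m (mult i) 1) ⟩
        2 * size G * mult i ∎

    module NonNested (a b v : Subgraph G) (a-tube : IsTube G a) (v-tube : IsTube G v)
        (a⊆v : a ⊆ᴳ v) (b⊆v : b ⊆ᴳ v)
        (x : Fin n) (x∈a∖b : (V a x ∧ not (V b x)) ≡ true)
        (y : Fin n) (y∈b∖a : (V b y ∧ not (V a y)) ≡ true) where

      nodes<nodes-v : ∀ s t → s ⊆ᴳ v → t ⊆ᴳ v → ∀ z → (V t z ∧ not (V s z)) ≡ true →
        suc (nodesOf G s) ≤ nodesOf G v
      nodes<nodes-v s t s⊆v t⊆v z z∈t∖s = begin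
        suc (nodesOf G s)                                          ≡⟨ +-comm 1 _ ⟩
        nodesOf G s + 1                                            ≤⟨ +-monoʳ-≤ _ (count-pos n _ z z∈t∖s) ⟩
        nodesOf G s + count n (λ w → V t w ∧ not (V s w))          ≡⟨ sym (count-additive n _ _ _ (λ w → split (V s w) (V t w))) ⟩
        count n (λ w → V s w ∨ V t w)                              ≤⟨ count-mono n _ _ (λ w h → [ proj₁ s⊆v w , proj₁ t⊆v w ]′ (∨-elim (V s w) _ h)) ⟩
        nodesOf G v                                                ∎
        where
        open ≤-Reasoning
        split : ∀ r s → [ r ∨ s ] ≡ [ r ] + [ s ∧ not r ]
        split false false = refl
        split false true  = refl
        split true  false = refl
        split true  true  = refl

      nodes-a<nodes-v : suc (nodesOf G a) ≤ nodesOf G v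
      nodes-a<nodes-v = nodes<nodes-v a b a⊆v b⊆v y y∈b∖a

      nodes-b<nodes-v : suc (nodesOf G b) ≤ nodesOf G v
      nodes-b<nodes-v = nodes<nodes-v b a b⊆v a⊆v x x∈a∖b

      -- a path in v from x to y uses an edge, as x ≠ y
      has-edge : 1 ≤ totalEdges
      has-edge = first-edge (proj₂ (proj₁ v-tube) x y (proj₁ a⊆v x (proj₁ (∧-elim (V a x) _ x∈a∖b)))
                                                       (proj₁ b⊆v y (proj₁ (∧-elim (V b y) _ y∈b∖a))))
                            x∈a∖b y∈b∖a
        where
        distinct : ∀ r s → (r ∧ not s) ≡ true → (s ∧ not r) ≡ true → ⊥
        distinct true  true  () _
        distinct true  false _  ()
        distinct false _     () _
        first-edge : ∀ {x y} → Reach G v x y → (V a x ∧ not (V b x)) ≡ true → (V b y ∧ not (V a y)) ≡ true →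
          1 ≤ totalEdges
        first-edge {x} here x∈ y∈   = ⊥-elim (distinct (V a x) (V b x) x∈ y∈)
        first-edge (step i _ _ _ _) _ _ = ≤-trans (multPos i) (term≤sum p mult i)

      size≥3 : 3 ≤ size G
      size≥3 = +-mono-≤ (≤-trans (≤-trans (s≤s (count-pos n (V a) _ (proj₂ (proj₁ (proj₁ a-tube))))) nodes-a<nodes-v)
                                 (count≤ n (V v)))
                        has-edge

      c≥9 : 9 ≤ cst G
      c≥9 = *-mono-≤ size≥3 size≥3

      -- Everything but the edge terms is dominated by c^|V(v)| = c · c^(|V(v)| − 1).
      small-terms : ∀ Lg →
        cst G ^ nodesOf G a + cst G ^ nodesOf G b + outside G a * outside G a + outside G b * outside G b
          + p + totalEdges + sumℕ p (separatorTotal Lg) < cst G ^ nodesOf G v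
      small-terms Lg = <-≤-trans
        (small-sum< c q _ _ _ _ _ _ _ c≥9 (≤-trans 1≤c c≤q)
                    (nodes≤q a nodes-a<nodes-v) (nodes≤q b nodes-b<nodes-v)
                    (≤-trans (square≤c a) c≤q) (≤-trans (square≤c b) c≤q)
                    (≤-trans (≤-trans bundles≤edges edges≤c) c≤q) (≤-trans edges≤c c≤q) separators≤2q)
        (≤-reflexive (cong (c ^_) (sym v-nodes)))
        where
        c = cst G
        s = size G
        1≤c : 1 ≤ c
        1≤c = ≤-trans (s≤s z≤n) c≥9
        instance
          c≢0 : ℕ.NonZero c
          c≢0 = ℕ.>-nonZero 1≤c
        r = nodesOf G v ∸ 1
        v-nodes : nodesOf G v ≡ suc r
        v-nodes = sym (m+[n∸m]≡n (≤-trans (s≤s z≤n) nodes-a<nodes-v))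
        q = c ^ r
        c≤q : c ≤ q
        c≤q = ≤-trans (≤-reflexive (sym (*-identityʳ c)))
                (^-monoʳ-≤ c {1} {r} (≤-pred (≤-trans (s≤s (count-pos n (V a) _ (proj₂ (proj₁ (proj₁ a-tube)))))
                                                      (≤-trans nodes-a<nodes-v (≤-reflexive v-nodes)))))
        square≤c : ∀ t → outside G t * outside G t ≤ c
        square≤c t = *-mono-≤ (outside≤size t) (outside≤size t)
        edges≤size : totalEdges ≤ s
        edges≤size = m≤n+m totalEdges n
        edges≤c : totalEdges ≤ c
        edges≤c = ≤-trans edges≤size (m≤m*n s s {{ℕ.>-nonZero (≤-trans (s≤s z≤n) size≥3)}})
        bundles≤edges : p ≤ totalEdges
        bundles≤edges = ≤-trans (≤-reflexive (sym (trans (sum-const p 1) (*-identityʳ p)))) (sum-mono p multPos)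
        nodes≤q : ∀ t → suc (nodesOf G t) ≤ nodesOf G v → c ^ nodesOf G t ≤ q
        nodes≤q t t<v = ^-monoʳ-≤ c (≤-pred (≤-trans t<v (≤-reflexive v-nodes)))
        separators≤2q : sumℕ p (separatorTotal Lg) ≤ 2 * q
        separators≤2q = ≤-trans (separatorTotal-sum Lg) (≤-trans (≤-reflexive (*-assoc 2 s totalEdges))
                          (*-monoʳ-≤ 2 (≤-trans (*-monoʳ-≤ s edges≤size) c≤q)))

      module _ (W : List (Subgraph G)) (W-spec : ∀ K → _∈_ G K W ⇔ IsComponentOf G K (a ∩ᴳ b))
               (ord : (i : Fin p) → Fin (mult i) → Fin (mult i)) (ord-bijective : ∀ i → Bijective _≡_ _≡_ (ord i))
               (v-initial : ∀ i → IsInitialSegment (mult i) (λ x → E v i (ord i x)))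
               (bc : BundleCompatible G a b) where

        newWeights : ℕ
        newWeights = sumℕ p (λ i → weightOf (cst G) (mult i) (newEdgeAt a b v ord i))

        edge-terms : edgeTerms a + edgeTerms b + newWeights ≤ edgeTerms v + (p + sumOver W edgeTerms)
        edge-terms = begin
          edgeTerms a + edgeTerms b + newWeights
            ≡⟨ trans (cong (_+ newWeights) (sym (sum-+ p _ _))) (sym (sum-+ p _ _)) ⟩
          sumℕ p (λ i → c ^ edgesOf G a i + c ^ edgesOf G b i + weightOf c (mult i) (newEdgeAt a b v ord i))
            ≤⟨ sum-mono p (λ i → edge-bundle-bound c a b v ord i a⊆v b⊆v (ord-bijective i) (v-initial i) (bc i)) ⟩
          sumℕ p (λ i → c ^ edgesOf G v i + c ^ edgesOf G (a ∩ᴳ b) i)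
            ≤⟨ sum-mono p (λ i → +-monoʳ-≤ (c ^ edgesOf G v i) (meet-bundle-bound c a b W W-spec i)) ⟩
          sumℕ p (λ i → c ^ edgesOf G v i + (1 + sumOver W (λ w → c ^ edgesOf G w i)))
            ≡⟨ trans (sum-+ p _ _) (cong (edgeTerms v +_) (trans (sum-+ p _ _)
                 (cong₂ _+_ (trans (sum-const p 1) (*-identityʳ p)) (sum-sumOver-swap W (λ i w → c ^ edgesOf G w i))))) ⟩
          edgeTerms v + (p + sumOver W edgeTerms) ∎
          where
          open ≤-Reasoning
          c = cst G
          instance
            c≢0 : ℕ.NonZero c
            c≢0 = ℕ.>-nonZero (≤-trans (s≤s z≤n) c≥9)

        sumF-bound : ∀ Lg → sumF G ord Lg a b v ℤ.≤ ℤ.+ (newWeights + totalEdges + sumℕ p (separatorTotal Lg))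
        sumF-bound Lg =
          ℤP.≤-trans (sumℤ-≤ p _ _ (λ i → f-bundle-bound (≤-trans (s≤s z≤n) c≥9) a b v ord Lg i))
                     (ℤP.≤-reflexive (cong ℤ.+_ (trans (sum-+ p _ _) (cong (_+ sumℕ p (separatorTotal Lg)) (sum-+ p _ _)))))

        Λ-bound : ∀ Lg → Λ G a + Λ G b + (newWeights + totalEdges + sumℕ p (separatorTotal Lg))
                         < Λ G v + sumOver W (Λ G)
        Λ-bound Lg = begin-strict
          (Na + edgeTerms a + Qa) + (Nb + edgeTerms b + Qb) + (newWeights + totalEdges + σs)
            ≡⟨ regroup Na Nb Qa Qb (edgeTerms a) (edgeTerms b) newWeights totalEdges σs ⟩
          (Na + Nb + Qa + Qb + totalEdges + σs) + (edgeTerms a + edgeTerms b + newWeights)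
            ≤⟨ +-monoʳ-≤ (Na + Nb + Qa + Qb + totalEdges + σs) edge-terms ⟩
          (Na + Nb + Qa + Qb + totalEdges + σs) + (edgeTerms v + (p + sumOver W edgeTerms))
            ≡⟨ regroup′ Na Nb Qa Qb totalEdges σs (edgeTerms v) p (sumOver W edgeTerms) ⟩
          (Na + Nb + Qa + Qb + p + totalEdges + σs) + (edgeTerms v + sumOver W edgeTerms)
            <⟨ +-monoˡ-< _ (small-terms Lg) ⟩
          cst G ^ nodesOf G v + (edgeTerms v + sumOver W edgeTerms)
            ≤⟨ +-monoʳ-≤ (cst G ^ nodesOf G v) (+-monoʳ-≤ (edgeTerms v) edges≤Λ) ⟩
          cst G ^ nodesOf G v + (edgeTerms v + sumOver W (Λ G))
            ≤⟨ ≤-reflexive (sym (+-assoc (cst G ^ nodesOf G v) _ _)) ⟩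
          cst G ^ nodesOf G v + edgeTerms v + sumOver W (Λ G)
            ≤⟨ +-monoˡ-≤ (sumOver W (Λ G)) (m≤m+n _ (outside G v * outside G v)) ⟩
          Λ G v + sumOver W (Λ G) ∎
          where
          open ≤-Reasoning
          Na = cst G ^ nodesOf G a
          Nb = cst G ^ nodesOf G b
          Qa = outside G a * outside G a
          Qb = outside G b * outside G b
          σs = sumℕ p (separatorTotal Lg)
          edges≤Λ : sumOver W edgeTerms ≤ sumOver W (Λ G)
          edges≤Λ = sumOver-mono W _ _ (λ w → ≤-trans (m≤n+m _ (cst G ^ nodesOf G w)) (m≤m+n _ _))
          regroup : ∀ na nb qa qb ea eb nw et σ →
            (na + ea + qa) + (nb + eb + qb) + (nw + et + σ) ≡ (na + nb + qa + qb + et + σ) + (ea + eb + nw)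
          regroup = solve-∀
          regroup′ : ∀ na nb qa qb et σ ev p′ we →
            (na + nb + qa + qb + et + σ) + (ev + (p′ + we)) ≡ (na + nb + qa + qb + p′ + et + σ) + (ev + we)
          regroup′ = solve-∀

    non-nested-case : ∀ a b → IsTube G a → BundleCompatible G a b →
      ∀ x → (V a x ∧ not (V b x)) ≡ true → ∀ y → (V b y ∧ not (V a y)) ≡ true →
      (W : List (Subgraph G)) → (∀ K → _∈_ G K W ⇔ IsComponentOf G K (a ∩ᴳ b)) →
      (v : Subgraph G) → IsMinimalTubeContaining G a b v →
      (T : List (Subgraph G)) → IsMaximalTubing G T → _∈_ G v T →
      (ord : (i : Fin p) → Fin (mult i) → Fin (mult i)) → IsBundleOrdering G T ord →
      (Lg : (i : Fin p) → ℕ → Subgraph G) →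
      ℤ.+ Λ G a ℤ.< ((ℤ.+ Λ G v ℤ.- ℤ.+ Λ G b) ℤ.+ sumΛ G W) ℤ.- sumF G ord Lg a b v
    non-nested-case a b a-tube bc x x∈a∖b y y∈b∖a W W-spec v (v-tube , a⊆v , b⊆v , _)
                    T ((_ , T-compatible , _) , _) v∈T ord ord-ok Lg =
      subst (λ z → ℤ.+ Λ G a ℤ.< ((ℤ.+ Λ G v ℤ.- ℤ.+ Λ G b) ℤ.+ z) ℤ.- sumF G ord Lg a b v)
            (sym (sumΛ≡sumOver W))
            (integer-form (Λ G a) (Λ G b) (Λ G v) (sumOver W (Λ G)) _ _
                          (sumF-bound W W-spec ord (proj₁ ord-ok) v-initial bc Lg)
                          (Λ-bound W W-spec ord (proj₁ ord-ok) v-initial bc Lg))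
      where
      open NonNested a b v a-tube v-tube a⊆v b⊆v x x∈a∖b y y∈b∖a
      v-initial = tube-edges-initial v T T-compatible v∈T ord ord-ok

open import Data.Nat using (ℕ)
open import Data.Fin using (Fin)
open import Data.Integer using (+_; _+_; _-_; _<_)
open import Data.List using (List)
open import Data.List.Relation.Unary.All using (All)
open import Data.List.Relation.Unary.AllPairs using (AllPairs)
open import Data.Sum using (_⊎_; inj₁; inj₂)
open import Data.Product using (_,_)
open import Relation.Nullary using (¬_)
open import Function.Bundles using (_⇔_)
open Proof using (inclusion-or-witness; nested-case; non-nested-case)

lemma15 : (G : Graph) (a b : Subgraph G) →
    IsTube G a → IsTube G b → BundleCompatible G a b →
    Adjacent G a b ⊎ ProperlyIntersecting G a b →
    (W : List (Subgraph G)) → All (IsTube G) W → AllPairs (λ x y → ¬ (_≈_ G x y)) W →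
    (∀ K → (_∈_ G K W) ⇔ IsComponentOf G K (_∩_ G a b)) →
    (v : Subgraph G) → IsMinimalTubeContaining G a b v →
    (T : List (Subgraph G)) → IsMaximalTubing G T → _∈_ G v T →
    (ord : (i : Fin (Graph.p G)) → Fin (Graph.mult G i) → Fin (Graph.mult G i)) →
    IsBundleOrdering G T ord →
    (Lg : (i : Fin (Graph.p G)) → ℕ → Subgraph G) → IsSeparatingFamily G T ord Lg →
    + Λ G a < ((+ Λ G v - + Λ G b) + sumΛ G W) - sumF G ord Lg a b v
lemma15 G a b a-tube b-tube bc adj-or-pi W _ W-distinct W-spec v v-minimal T T-maximal v∈T ord ord-ok Lg _
  with inclusion-or-witness (Graph.n G) (V a) (V b) | inclusion-or-witness (Graph.n G) (V b) (V a)
... | inj₁ Va⊆Vb | _ =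
  nested-case G a b a-tube b-tube bc (inj₁ Va⊆Vb) adj-or-pi W W-distinct W-spec v v-minimal ord Lg
... | inj₂ _ | inj₁ Vb⊆Va =
  nested-case G a b a-tube b-tube bc (inj₂ Vb⊆Va) adj-or-pi W W-distinct W-spec v v-minimal ord Lg
... | inj₂ (x , x∈a∖b) | inj₂ (y , y∈b∖a) =
  non-nested-case G a b a-tube bc x x∈a∖b y y∈b∖a W W-spec v v-minimal T T-maximal v∈T ord ord-ok Lg
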